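{- Let $n\ge 8$ be divisible by $4$. Let $J=J_0\cup J_1\cup J_2\cup J_3\cup J_4\subseteq B_n$, where \begin{align*} J_0&=\{(0;0),(0;1),(0;2),(0;3),(0;4)\},\\ J_1&=\{(i;3i+2),(i;3i+3),(i;3i+4): 1\le i\le n/4-1\},\\ J_2&=\{(n/4;3n/4+2)\},\\ J_3&=\{(i;3i),(i;3i+1),(i;3i+2): n/4+1\le i\le n/2-1\},\\ J_4&=\{(i;i-n/2+1),(i;i),(i;i+1): n/2\le i\le n-1\}. \end{align*} Then each column of $B_n$ contains exactly $3$ elements of $J$, each symbol in $N_n$ appears in exactly $3$ elements of $J$, and each row of $B_n$ contains exactly $3$ elements of $J$, except row $0$, which contains $5$ elements of $J$, and row $n/4$, which contains $1$ element of $J$.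
   Context: $N_n=\{0,\dots,n-1\}$. $B_n$ is the addition table of the integers mod $n$, viewed as the set of entries (row, column, symbol) $(x,y,x+y\bmod n)$. The notation $(x;y)$ denotes the entry $(x,y,z)$ of $B_n$ with $z\equiv x+y\pmod n$; all index calculations are reduced mod $n$ to an element of $N_n$. -}

module Defs where

open import Data.Nat using (ℕ; _+_; _*_; _∸_; NonZero)
open import Data.Nat.DivMod using (_%_; _/_)
import Data.Nat.Properties as ℕP
open import Data.Product using (_×_; _,_; proj₁; proj₂)
open import Data.Product.Properties using (≡-dec)
open import Data.List using (List; map; concatMap; upTo; filter; length; _++_; [_])
open import Relation.Nullary using (_×-dec_)
open import Data.List.Membership.DecPropositional (≡-dec ℕP._≟_ ℕP._≟_) using (_∈?_)

-- A cell (row , column) of B_n; the symbol is (row + column) mod n.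
Cell : Set
Cell = ℕ × ℕ

-- (x ; y): the entry in row x mod n, column y mod n.
entry : (n : ℕ) → .{{NonZero n}} → ℕ → ℕ → Cell
entry n x y = (x % n , y % n)

-- the integers a, a+1, ..., b (empty if b < a)
range : ℕ → ℕ → List ℕ
range a b = map (a +_) (upTo ((b + 1) ∸ a))

J₀ : (n : ℕ) → .{{NonZero n}} → List Cell
J₀ n = map (entry n 0) (upTo 5)

J₁ : (n : ℕ) → .{{NonZero n}} → List Cell
J₁ n = concatMap (λ i → entry n i (3 * i + 2) ∷' entry n i (3 * i + 3) ∷' [ entry n i (3 * i + 4) ])
                 (range 1 (n / 4 ∸ 1))
  where
  infixr 5 _∷'_
  _∷'_ : Cell → List Cell → List Cell
  c ∷' cs = [ c ] ++ cs

J₂ : (n : ℕ) → .{{NonZero n}} → List Cell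
J₂ n = [ entry n (n / 4) (3 * (n / 4) + 2) ]

J₃ : (n : ℕ) → .{{NonZero n}} → List Cell
J₃ n = concatMap (λ i → [ entry n i (3 * i) ] ++ [ entry n i (3 * i + 1) ] ++ [ entry n i (3 * i + 2) ])
                 (range (n / 4 + 1) (n / 2 ∸ 1))

-- i - n/2 + 1 is nonnegative for i ≥ n/2
J₄ : (n : ℕ) → .{{NonZero n}} → List Cell
J₄ n = concatMap (λ i → [ entry n i (i ∸ n / 2 + 1) ] ++ [ entry n i i ] ++ [ entry n i (i + 1) ])
                 (range (n / 2) (n ∸ 1))

-- J as a list of cells; the set J is the set of its members.
J : (n : ℕ) → .{{NonZero n}} → List Cell
J n = J₀ n ++ J₁ n ++ J₂ n ++ J₃ n ++ J₄ n

cells : ℕ → List Cell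
cells n = concatMap (λ x → map (x ,_) (upTo n)) (upTo n)

-- number of elements of J in row r (counted as a set: distinct cells)
rowCount : (n : ℕ) → .{{NonZero n}} → ℕ → ℕ
rowCount n r = length (filter (λ y → (r , y) ∈? J n) (upTo n))

colCount : (n : ℕ) → .{{NonZero n}} → ℕ → ℕ
colCount n c = length (filter (λ x → (x , c) ∈? J n) (upTo n))

symCount : (n : ℕ) → .{{NonZero n}} → ℕ → ℕ
symCount n s = length (filter (λ p → ((proj₁ p + proj₂ p) % n ℕP.≟ s) ×-dec (p ∈? J n)) (cells n))

module Submission where

-- Every count in the statement is the length of a filtered list, so by the
-- counting principle count-exactly it suffices to exhibit, for each line, a
-- duplicate-free list of the entries of J on it.  For n = 4m with m ≥ 3
-- (module Design):
--   * J, whose entries are given modulo n, is decoded into the explicit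
--     description InJ: three families T₁, T₂, T₃ of cells given by linear
--     formulas in [0, n) × [0, n) (J⇒InJ, InJ⇒J);
--   * rows: each band of rows lists its columns (row-0, row-band₁, ...);
--   * columns: every column meets each Tᵢ exactly once (Tᵢ-exists,
--     Tᵢ-unique), in three different rows;
--   * symbols: J splits again into families S₁, S₂, S₃, each meeting every
--     symbol exactly once (classify, Sᵢ-exists, Sᵢ-unique), in distinct cells.
-- Linear side conditions are discharged by certificates checked by the
-- ring solver (≤-by, ≰-by, ≡-by).  The case n = 8 is settled by evaluation.

open import Defs
open import Data.Nat
open import Data.Nat.Properties
open import Data.Nat.DivMod
open import Data.Nat.Divisibility using (_∣_; divides)
open import Data.Nat.Tactic.RingSolver using (solve; solve-∀)
open import Data.List using (List; []; _∷_; _++_; map; concatMap; upTo; filter; length; cartesianProduct)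
open import Data.List.Membership.Propositional using (_∈_; find; lose)
open import Data.List.Membership.Propositional.Properties
  using (∈-map⁻; ∈-map⁺; ∈-++⁻; ∈-++⁺ˡ; ∈-++⁺ʳ; ∈-upTo⁺; ∈-upTo⁻; ∈-concatMap⁻; ∈-concatMap⁺;
         ∈-filter⁺; ∈-filter⁻; ∈-cartesianProduct⁺)
open import Data.List.Membership.Propositional.Properties.WithK using (unique∧set⇒bag)
open import Data.List.Relation.Binary.BagAndSetEquality using (∼bag⇒↭)
open import Data.List.Relation.Binary.Permutation.Propositional.Properties using (↭-length)
open import Data.List.Relation.Unary.Any using (here; there)
import Data.List.Relation.Unary.All as All
import Data.List.Relation.Unary.AllPairs as AllPairs
open import Data.List.Relation.Unary.Unique.Propositional using (Unique)
import Data.List.Relation.Unary.Unique.Propositional.Properties as Unique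
open import Data.Product using (_×_; _,_; proj₁; proj₂; Σ-syntax)
open import Data.Product.Properties using (≡-dec)
open import Data.List.Membership.DecPropositional (≡-dec _≟_ _≟_) using (_∈?_)
open import Data.Sum using (_⊎_; inj₁; inj₂; [_,_]′)
open import Data.Empty using (⊥; ⊥-elim)
open import Function.Bundles using (mk⇔)
open import Level using (0ℓ)
open import Relation.Binary.PropositionalEquality hiding (J)
open import Relation.Nullary using (Dec; yes; no; _×-dec_; _⊎-dec_)
open import Relation.Nullary.Decidable using (True; toWitness)
open import Relation.Binary.Definitions using (Tri; tri<; tri≈; tri>)
open import Relation.Unary using (Pred; Decidable)

count-exactly : {A : Set} {P : Pred A 0ℓ} (P? : Decidable P) {xs W : List A} →
  Unique xs → Unique W →
  (∀ {z} → z ∈ W → z ∈ xs × P z) → (∀ {z} → z ∈ xs → P z → z ∈ W) →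
  length (filter P? xs) ≡ length W
count-exactly P? {xs} {W} uxs uW sound complete =
  ↭-length (∼bag⇒↭ (unique∧set⇒bag (Unique.filter⁺ P? uxs) uW (mk⇔ to from)))
  where
  to : ∀ {z} → z ∈ filter P? xs → z ∈ W
  to z∈ = let (z∈xs , pz) = ∈-filter⁻ P? z∈ in complete z∈xs pz
  from : ∀ {z} → z ∈ W → z ∈ filter P? xs
  from z∈W = let (z∈xs , pz) = sound z∈W in ∈-filter⁺ P? z∈xs pz

unique₃ : {A : Set} {a b c : A} → a ≢ b → a ≢ c → b ≢ c → Unique (a ∷ b ∷ c ∷ [])
unique₃ a≢b a≢c b≢c =
  (a≢b All.∷ a≢c All.∷ All.[]) AllPairs.∷ (b≢c All.∷ All.[]) AllPairs.∷ All.[] AllPairs.∷ AllPairs.[]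

cells≡square : ∀ n → cells n ≡ cartesianProduct (upTo n) (upTo n)
cells≡square n = go (upTo n)
  where
  go : (xs : List ℕ) → concatMap (λ x → map (x ,_) (upTo n)) xs ≡ cartesianProduct xs (upTo n)
  go []       = refl
  go (x ∷ xs) = cong (map (x ,_) (upTo n) ++_) (go xs)

cells-unique : ∀ n → Unique (cells n)
cells-unique n = subst Unique (sym (cells≡square n))
                   (Unique.cartesianProduct⁺ (Unique.upTo⁺ n) (Unique.upTo⁺ n))

∈-cells : ∀ {n x y} → x < n → y < n → (x , y) ∈ cells n
∈-cells {n} x<n y<n = subst ((_ , _) ∈_) (sym (cells≡square n))
                        (∈-cartesianProduct⁺ (∈-upTo⁺ x<n) (∈-upTo⁺ y<n))

-- Linear arithmetic by certificate: a ≤ b follows from a hypothesis c ≤ d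
-- together with an identity a + d + w ≡ b + c (checked by the ring solver).
≤-by : ∀ {a b c d} (w : ℕ) → c ≤ d → a + d + w ≡ b + c → a ≤ b
≤-by {a} {b} {c} {d} w c≤d eq = +-cancelʳ-≤ c a b (begin
  a + c      ≤⟨ +-monoʳ-≤ a c≤d ⟩
  a + d      ≤⟨ m≤m+n (a + d) w ⟩
  a + d + w  ≡⟨ eq ⟩
  b + c      ∎)
  where open ≤-Reasoning

-- Scaling an inequality (stated with plain products so that certificates
-- built from it are readable by the ring solver).
scale : ∀ k {a b} → a ≤ b → k * a ≤ k * b
scale k a≤b = *-monoʳ-≤ k a≤b

≰-by : ∀ {c d} (w : ℕ) → c ≤ d → 1 + d + w ≡ c → ⊥
≰-by w c≤d eq with () ← ≤-by {1} {0} w c≤d eq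

≡-by : ∀ {p q l r} → l ≡ r → p + r ≡ q + l → p ≡ q
≡-by {p} {q} {l} l≡r eq = +-cancelʳ-≡ l p q (trans (cong (p +_) l≡r) eq)

infixl 6 _+≡_
_+≡_ : ∀ {a b c d} → a ≡ b → c ≡ d → a + c ≡ b + d
_+≡_ = cong₂ _+_

remainder-unique : ∀ d .{{_ : NonZero d}} {q q′ r r′} → r < d → r′ < d →
                   d * q + r ≡ d * q′ + r′ → r ≡ r′
remainder-unique d {q} {q′} {r} {r′} r<d r′<d eq = begin
  r                    ≡⟨ sym (m<n⇒m%n≡m r<d) ⟩
  r % d                ≡⟨ sym ([m+kn]%n≡m%n r q d) ⟩
  (r + q * d) % d      ≡⟨ cong (_% d) (swap-sum r q) ⟩
  (d * q + r) % d      ≡⟨ cong (_% d) eq ⟩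
  (d * q′ + r′) % d    ≡⟨ cong (_% d) (sym (swap-sum r′ q′)) ⟩
  (r′ + q′ * d) % d    ≡⟨ [m+kn]%n≡m%n r′ q′ d ⟩
  r′ % d               ≡⟨ m<n⇒m%n≡m r′<d ⟩
  r′                   ∎
  where
  open ≡-Reasoning
  swap-sum : ∀ a b → a + b * d ≡ d * b + a
  swap-sum a b = trans (+-comm a (b * d)) (cong (_+ a) (*-comm b d))

quotient-unique : ∀ d .{{_ : NonZero d}} {q q′ r r′} → r < d → r′ < d →
                  d * q + r ≡ d * q′ + r′ → q ≡ q′
quotient-unique d {q} {q′} {r} r<d r′<d eq with refl ← remainder-unique d r<d r′<d eq =
  *-cancelˡ-≡ q q′ d (+-cancelʳ-≡ r (d * q) (d * q′) eq)

range⁻ : ∀ {a b i} → 0 < b → i ∈ range a (b ∸ 1) → a ≤ i × i < b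
range⁻ {a} {b} 0<b i∈ with ∈-map⁻ (a +_) i∈
... | j , j∈ , refl = m≤m+n a j , subst (_≤ b) (trans (+-comm (suc j) a) (+-suc a j)) (m≤o∸n⇒m+n≤o (suc j) a≤b j<b∸a)
  where
  j<b∸a : j < b ∸ a
  j<b∸a = subst (λ t → j < t ∸ a) (m∸n+n≡m 0<b) (∈-upTo⁻ j∈)
  a≤b : a ≤ b
  a≤b = <⇒≤ (m∸n≢0⇒n<m (λ b∸a≡0 → n≮0 (subst (j <_) b∸a≡0 j<b∸a)))

range⁺ : ∀ {a b i} → a ≤ i → i < b → i ∈ range a (b ∸ 1)
range⁺ {a} {b} {i} a≤i i<b = subst (_∈ range a (b ∸ 1)) (m+[n∸m]≡n a≤i)
  (∈-map⁺ (a +_) (∈-upTo⁺ (subst (λ t → i ∸ a < t ∸ a) (sym (m∸n+n≡m (<-≤-trans z<s i<b)))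
                                 (∸-monoˡ-< i<b a≤i))))

remainder-≢ : ∀ d .{{_ : NonZero d}} q q′ {r r′} → r < d → r′ < d → r ≢ r′ → d * q + r ≢ d * q′ + r′
remainder-≢ d q q′ r<d r′<d r≢r′ eq = r≢r′ (remainder-unique d r<d r′<d eq)

divide : ∀ d .{{_ : NonZero d}} v → Σ[ q ∈ ℕ ] Σ[ r ∈ ℕ ] r < d × v ≡ d * q + r
divide d v = v / d , v % d , m%n<n v d ,
  trans (m≡m%n+[m/n]*n v d) (trans (+-comm (v % d) (v / d * d)) (cong (_+ v % d) (*-comm (v / d) d)))

quotient-< : ∀ d {q r b} → d * q + r < d * b → q < b
quotient-< d {q} {r} {b} lt = *-cancelˡ-< d q b (≤-<-trans (m≤m+n (d * q) r) lt)

quotient-≥ : ∀ d {b q r} → r < d → d * b ≤ d * q + r → b ≤ q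
quotient-≥ d {b} {q} {r} r<d le = m<1+n⇒m≤n (*-cancelˡ-< d b (suc q) (begin-strict
  d * b      ≤⟨ le ⟩
  d * q + r  <⟨ +-monoʳ-< (d * q) r<d ⟩
  d * q + d  ≡⟨ trans (+-comm (d * q) d) (sym (*-suc d q)) ⟩
  d * suc q  ∎))
  where open ≤-Reasoning

%-wrap : ∀ {n} .{{_ : NonZero n}} {y v} → y + n ≡ v → y < n → v % n ≡ y
%-wrap {n} {y} refl y<n = trans ([m+n]%n≡m%n y n) (m<n⇒m%n≡m y<n)

%-split : ∀ {n} .{{_ : NonZero n}} {v} → n ≤ v → v < n + n → v ≡ v % n + n
%-split {n} {v} n≤v v<2n = begin
  v                      ≡⟨ sym (m∸n+n≡m n≤v) ⟩
  v ∸ n + n              ≡⟨ cong (_+ n) (sym (%-wrap (m∸n+n≡m n≤v) v∸n<n)) ⟩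
  v % n + n              ∎
  where
  open ≡-Reasoning
  v∸n<n : v ∸ n < n
  v∸n<n = m<n+o⇒m∸n<o v n v<2n

%-suc : ∀ {n} .{{_ : NonZero n}} {r} → r < n →
        (r + 1 < n × (r + 1) % n ≡ r + 1) ⊎ (r + 1 ≡ n × (r + 1) % n ≡ 0)
%-suc {n} {r} r<n with r + 1 <? n
... | yes r+1<n = inj₁ (r+1<n , m<n⇒m%n≡m r+1<n)
... | no r+1≮n  = inj₂ (r+1≡n , trans (cong (_% n) r+1≡n) (n%n≡0 n))
  where
  r+1≡n : r + 1 ≡ n
  r+1≡n = ≤-antisym (subst (_≤ n) (+-comm 1 r) r<n) (≮⇒≥ r+1≮n)

%-shift-≢ : ∀ {n} .{{_ : NonZero n}} a {d} → 0 < d → d < n → (a + d) % n ≢ a % n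
%-shift-≢ {n} a {d} 0<d d<n same = by-cases (r + d <? n)
  where
  r : ℕ
  r = a % n
  r<n : r < n
  r<n = m%n<n a n
  swap : ∀ t → r + t + d ≡ r + d + t
  swap t = trans (+-assoc r t d) (trans (cong (r +_) (+-comm t d)) (sym (+-assoc r d t)))
  reduce : (a + d) % n ≡ (r + d) % n
  reduce = trans (cong (λ t → (t + d) % n) (m≡m%n+[m/n]*n a n))
    (trans (cong (_% n) (swap (a / n * n))) ([m+kn]%n≡m%n (r + d) (a / n) n))
  same′ : (r + d) % n ≡ r
  same′ = trans (sym reduce) same
  by-cases : Dec (r + d < n) → ⊥
  by-cases (yes r+d<n) = <-irrefl (sym d≡0) 0<d
    where
    d≡0 : d ≡ 0
    d≡0 = +-cancelˡ-≡ r d 0 (trans (trans (sym (m<n⇒m%n≡m r+d<n)) same′) (sym (+-identityʳ r)))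
  by-cases (no r+d≮n) = <-irrefl d≡n d<n
    where
    e+n : r + d ∸ n + n ≡ r + d
    e+n = m∸n+n≡m (≮⇒≥ r+d≮n)
    e≡r : r + d ∸ n ≡ r
    e≡r = trans (sym (%-wrap e+n (m<n+o⇒m∸n<o (r + d) n (+-mono-< r<n d<n)))) same′
    d≡n : d ≡ n
    d≡n = +-cancelˡ-≡ r d n (trans (sym e+n) (cong (_+ n) e≡r))

-- The shape of the parts J₁, J₃, J₄ of J: three cells f i, g i, h i for
-- each i in the interval a, ..., b - 1.
Block : (ℕ → Cell) → (ℕ → Cell) → (ℕ → Cell) → ℕ → ℕ → List Cell
Block f g h a b = concatMap (λ i → f i ∷ g i ∷ h i ∷ []) (range a (b ∸ 1))

OneOf₃ : Cell → Cell → Cell → Cell → Set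
OneOf₃ c p q r = c ≡ p ⊎ c ≡ q ⊎ c ≡ r

∈-Block⁻ : ∀ {f g h a b c} → 0 < b → c ∈ Block f g h a b →
           Σ[ i ∈ ℕ ] a ≤ i × i < b × OneOf₃ c (f i) (g i) (h i)
∈-Block⁻ {f} {g} {h} {a} {b} 0<b c∈ with find (∈-concatMap⁻ (λ i → f i ∷ g i ∷ h i ∷ []) c∈)
... | i , i∈ , c∈fgh = i , proj₁ bounds , proj₂ bounds , which c∈fgh
  where
  bounds : a ≤ i × i < b
  bounds = range⁻ 0<b i∈
  which : ∀ {c} → c ∈ f i ∷ g i ∷ h i ∷ [] → OneOf₃ c (f i) (g i) (h i)
  which (here refl)                 = inj₁ refl
  which (there (here refl))         = inj₂ (inj₁ refl)
  which (there (there (here refl))) = inj₂ (inj₂ refl)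

∈-Block⁺ : ∀ {f g h a b c} i → a ≤ i → i < b → OneOf₃ c (f i) (g i) (h i) → c ∈ Block f g h a b
∈-Block⁺ {f} {g} {h} i a≤i i<b c∈fgh =
  ∈-concatMap⁺ (λ i → f i ∷ g i ∷ h i ∷ []) (lose (range⁺ a≤i i<b) (position c∈fgh))
  where
  position : ∀ {c} → OneOf₃ c (f i) (g i) (h i) → c ∈ f i ∷ g i ∷ h i ∷ []
  position (inj₁ refl)        = here refl
  position (inj₂ (inj₁ refl)) = there (here refl)
  position (inj₂ (inj₂ refl)) = there (there (here refl))

Residue : ℕ → ℕ → ℕ → Set
Residue n v y = (y ≡ v × v < n) ⊎ (y + n ≡ v × y < n)

residue-exists : ∀ {n} .{{_ : NonZero n}} {v} → v < n + n → Σ[ y ∈ ℕ ] Residue n v y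
residue-exists {n} {v} v<2n with v <? n
... | yes v<n = v , inj₁ (refl , v<n)
... | no v≮n  = v ∸ n , inj₂ (m∸n+n≡m (≮⇒≥ v≮n) , m<n+o⇒m∸n<o v n v<2n)

residue-unique : ∀ {n v y y′} → Residue n v y → Residue n v y′ → y ≡ y′
residue-unique (inj₁ (y≡v , _))    (inj₁ (y′≡v , _))    = trans y≡v (sym y′≡v)
residue-unique (inj₁ (refl , v<n)) (inj₂ (y′+n≡v , _))  = ⊥-elim (<⇒≱ v<n (subst (_ ≤_) y′+n≡v (m≤n+m _ _)))
residue-unique (inj₂ (y+n≡v , _))  (inj₁ (refl , v<n))  = ⊥-elim (<⇒≱ v<n (subst (_ ≤_) y+n≡v (m≤n+m _ _)))
residue-unique (inj₂ (y+n≡v , _))  (inj₂ (y′+n≡v , _))  = +-cancelʳ-≡ _ _ _ (trans y+n≡v (sym y′+n≡v))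

∈-++₅⁻ : {A : Set} (l₀ l₁ l₂ l₃ : List A) {l₄ : List A} {c : A} →
         c ∈ l₀ ++ l₁ ++ l₂ ++ l₃ ++ l₄ → c ∈ l₀ ⊎ c ∈ l₁ ⊎ c ∈ l₂ ⊎ c ∈ l₃ ⊎ c ∈ l₄
∈-++₅⁻ l₀ l₁ l₂ l₃ c∈ with ∈-++⁻ l₀ c∈
... | inj₁ c∈₀ = inj₁ c∈₀
... | inj₂ c∈ with ∈-++⁻ l₁ c∈
... | inj₁ c∈₁ = inj₂ (inj₁ c∈₁)
... | inj₂ c∈ with ∈-++⁻ l₂ c∈
... | inj₁ c∈₂ = inj₂ (inj₂ (inj₁ c∈₂))
... | inj₂ c∈ with ∈-++⁻ l₃ c∈
... | inj₁ c∈₃ = inj₂ (inj₂ (inj₂ (inj₁ c∈₃)))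
... | inj₂ c∈₄ = inj₂ (inj₂ (inj₂ (inj₂ c∈₄)))

module Design (m : ℕ) (3≤m : 3 ≤ m) where

  0<n : 0 < m * 4
  0<n = ≤-by (3 * m + 2) 3≤m (solve (m ∷ []))

  instance
    n-nonZero : NonZero (m * 4)
    n-nonZero = >-nonZero 0<n

  n/4≡m : (m * 4) / 4 ≡ m
  n/4≡m = m*n/n≡m m 4

  n/2≡2m : (m * 4) / 2 ≡ 2 * m
  n/2≡2m = trans (cong (_/ 2) n≡2m*2) (m*n/n≡m (2 * m) 2)
    where
    n≡2m*2 : m * 4 ≡ 2 * m * 2
    n≡2m*2 = solve (m ∷ [])

  0<m : 0 < m
  0<m = <-≤-trans z<s 3≤m

  m<2m : m < 2 * m
  m<2m = ≤-by 2 3≤m (solve (m ∷ []))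

  2m<n : 2 * m < m * 4
  2m<n = ≤-by (m + 2) 3≤m (solve (m ∷ []))

  <2m⇒<n : ∀ {i} → i < 2 * m → i < m * 4
  <2m⇒<n i<2m = <-trans i<2m 2m<n

  <m⇒<2m : ∀ {i} → i < m → i < 2 * m
  <m⇒<2m i<m = <-trans i<m m<2m

  <5⇒<n : ∀ {k} → k < 5 → k < m * 4
  <5⇒<n {k} k<5 = ≤-by 7 (+-mono-≤ k<5 (scale 4 3≤m)) (solve (k ∷ m ∷ []))

  settle : ∀ (P : ℕ → ℕ → Set) {x y} → x < m * 4 → y < m * 4 → P x y → P (x % (m * 4)) (y % (m * 4))
  settle P x<n y<n = subst₂ P (sym (m<n⇒m%n≡m x<n)) (sym (m<n⇒m%n≡m y<n))

  -- Explicit description of J for n = 4m, as three families of cells; each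
  -- family meets every column exactly once (see the column count below).
  -- The first family: row 0, the band of J₁, the cell of J₂, and the part
  -- of J₃ that does not wrap around.
  data T₁ : ℕ → ℕ → Set where
    row₀      : ∀ k → k < 5 → T₁ 0 k
    band₁     : ∀ i k → 1 ≤ i → i < m → k < 3 → T₁ i (3 * i + (2 + k))
    row-m     : T₁ m (3 * m + 2)
    band₃     : ∀ i k → m < i → i < 2 * m → k < 3 → 3 * i + k < m * 4 → T₁ i (3 * i + k)

  -- The second family: the part of J₃ that wraps around, and the diagonal of J₄.
  data T₂ : ℕ → ℕ → Set where
    band₃-wrap : ∀ i k y → m < i → i < 2 * m → k < 3 → y + m * 4 ≡ 3 * i + k → T₂ i y
    diagonal   : ∀ i → 2 * m ≤ i → i < m * 4 → T₂ i i

  -- The third family: the other two cells in each row of J₄.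
  data T₃ : ℕ → ℕ → Set where
    back      : ∀ i y → 2 * m ≤ i → i < m * 4 → y + 2 * m ≡ i + 1 → T₃ i y
    next      : ∀ i → 2 * m ≤ i → i + 1 < m * 4 → T₃ i (i + 1)
    next-wrap : ∀ i → i + 1 ≡ m * 4 → T₃ i 0

  InJ : ℕ → ℕ → Set
  InJ x y = T₁ x y ⊎ T₂ x y ⊎ T₃ x y

  InJ′ : Cell → Set
  InJ′ (x , y) = InJ x y

  -- The columns 3i + k of J₃ wrap around at most once.
  band₃<2n : ∀ {i k} → i < 2 * m → k < 3 → 3 * i + k < m * 4 + m * 4
  band₃<2n {i} {k} i<2m k<3 = ≤-by (m + 3) (+-mono-≤ (scale 3 i<2m) (+-mono-≤ k<3 3≤m)) (solve (i ∷ k ∷ m ∷ []))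

  band₃-entry : ∀ i k → m < i → i < 2 * m → k < 3 → InJ′ (entry (m * 4) i (3 * i + k))
  band₃-entry i k m<i i<2m k<3 = by-cases (3 * i + k <? m * 4)
    where
    i<n = <2m⇒<n i<2m
    by-cases : Dec (3 * i + k < m * 4) → InJ′ (entry (m * 4) i (3 * i + k))
    by-cases (yes v<n) = settle InJ i<n v<n (inj₁ (band₃ i k m<i i<2m k<3 v<n))
    by-cases (no v≮n)  = subst₂ InJ (sym (m<n⇒m%n≡m i<n)) (sym (%-wrap y+n y<n))
                           (inj₂ (inj₁ (band₃-wrap i k y m<i i<2m k<3 y+n)))
      where
      y : ℕ
      y = 3 * i + k ∸ m * 4
      y+n : y + m * 4 ≡ 3 * i + k
      y+n = m∸n+n≡m (≮⇒≥ v≮n)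
      y<n : y < m * 4
      y<n = m<n+o⇒m∸n<o (3 * i + k) (m * 4) (band₃<2n i<2m k<3)

  entry≡ : ∀ {i v} → i < m * 4 → v < m * 4 → entry (m * 4) i v ≡ (i , v)
  entry≡ i<n v<n = cong₂ _,_ (m<n⇒m%n≡m i<n) (m<n⇒m%n≡m v<n)

  band₁<n : ∀ {i k} → i < m → k < 3 → 3 * i + (2 + k) < m * 4
  band₁<n {i} {k} i<m k<3 = ≤-by 1 (+-mono-≤ (+-mono-≤ (scale 3 i<m) k<3) 3≤m) (solve (i ∷ k ∷ m ∷ []))

  row-m<n : 3 * m + 2 < m * 4
  row-m<n = ≤-by 0 3≤m (solve (m ∷ []))

  0<n/4 : 0 < (m * 4) / 4
  0<n/4 = subst (0 <_) (sym n/4≡m) 0<m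

  0<n/2 : 0 < (m * 4) / 2
  0<n/2 = subst (0 <_) (sym n/2≡2m) (<-trans 0<m m<2m)

  back-column : ∀ {i} → 2 * m ≤ i → i ∸ 2 * m + 1 + 2 * m ≡ i + 1
  back-column {i} 2m≤i = begin
    i ∸ 2 * m + 1 + 2 * m  ≡⟨ +-assoc (i ∸ 2 * m) 1 (2 * m) ⟩
    i ∸ 2 * m + (1 + 2 * m) ≡⟨ cong (i ∸ 2 * m +_) (+-comm 1 (2 * m)) ⟩
    i ∸ 2 * m + (2 * m + 1) ≡⟨ sym (+-assoc (i ∸ 2 * m) (2 * m) 1) ⟩
    i ∸ 2 * m + 2 * m + 1  ≡⟨ cong (_+ 1) (m∸n+n≡m 2m≤i) ⟩
    i + 1                  ∎
    where open ≡-Reasoning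

  back-col≥1 : ∀ {i y} → 2 * m ≤ i → y + 2 * m ≡ i + 1 → 1 ≤ y
  back-col≥1 {i} {y} 2m≤i eq = ≤-by 0 (+-mono-≤ 2m≤i (≤-reflexive (sym eq))) (solve (i ∷ y ∷ m ∷ []))

  back-col≤2m : ∀ {i y} → i < m * 4 → y + 2 * m ≡ i + 1 → y ≤ 2 * m
  back-col≤2m {i} {y} i<n eq = ≤-by 0 (+-mono-≤ i<n (≤-reflexive eq)) (solve (i ∷ y ∷ m ∷ []))

  wrap-col<2m : ∀ {i k y} → i < 2 * m → k < 3 → y + m * 4 ≡ 3 * i + k → y < 2 * m
  wrap-col<2m {i} {k} {y} i<2m k<3 eq =
    ≤-by 0 (+-mono-≤ (+-mono-≤ (scale 3 i<2m) k<3) (≤-reflexive eq)) (solve (i ∷ k ∷ y ∷ m ∷ []))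

  J₀⇒InJ : ∀ {c} → c ∈ J₀ (m * 4) → InJ′ c
  J₀⇒InJ c∈ = decode (∈-map⁻ (entry (m * 4) 0) c∈)
    where
    decode : ∀ {c} → Σ[ k ∈ ℕ ] k ∈ upTo 5 × c ≡ entry (m * 4) 0 k → InJ′ c
    decode (k , k∈ , refl) = settle InJ 0<n (<5⇒<n k<5) (inj₁ (row₀ k k<5))
      where
      k<5 : k < 5
      k<5 = ∈-upTo⁻ k∈

  J₁⇒InJ : ∀ {c} → c ∈ J₁ (m * 4) → InJ′ c
  J₁⇒InJ c∈ = decode (∈-Block⁻ 0<n/4 c∈)
    where
    decode : ∀ {c} → Σ[ i ∈ ℕ ] 1 ≤ i × i < (m * 4) / 4 ×
               OneOf₃ c (entry (m * 4) i (3 * i + 2)) (entry (m * 4) i (3 * i + 3)) (entry (m * 4) i (3 * i + 4)) →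
             InJ′ c
    decode (i , 1≤i , i<n/4 , which) = column which
      where
      i<m : i < m
      i<m = subst (i <_) n/4≡m i<n/4
      band : ∀ k → k < 3 → InJ′ (entry (m * 4) i (3 * i + (2 + k)))
      band k k<3 = settle InJ (<2m⇒<n (<m⇒<2m i<m)) (band₁<n i<m k<3) (inj₁ (band₁ i k 1≤i i<m k<3))
      column : ∀ {c} → OneOf₃ c (entry (m * 4) i (3 * i + 2)) (entry (m * 4) i (3 * i + 3)) (entry (m * 4) i (3 * i + 4)) →
               InJ′ c
      column (inj₁ refl)        = band 0 (s≤s z≤n)
      column (inj₂ (inj₁ refl)) = band 1 (s≤s (s≤s z≤n))
      column (inj₂ (inj₂ refl)) = band 2 (s≤s (s≤s (s≤s z≤n)))

  J₂⇒InJ : ∀ {c} → c ∈ J₂ (m * 4) → InJ′ c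
  J₂⇒InJ (here refl) = subst (λ t → InJ′ (entry (m * 4) t (3 * t + 2))) (sym n/4≡m)
                         (settle InJ (<2m⇒<n m<2m) row-m<n (inj₁ row-m))

  J₃⇒InJ : ∀ {c} → c ∈ J₃ (m * 4) → InJ′ c
  J₃⇒InJ c∈ = decode (∈-Block⁻ 0<n/2 c∈)
    where
    decode : ∀ {c} → Σ[ i ∈ ℕ ] (m * 4) / 4 + 1 ≤ i × i < (m * 4) / 2 ×
               OneOf₃ c (entry (m * 4) i (3 * i)) (entry (m * 4) i (3 * i + 1)) (entry (m * 4) i (3 * i + 2)) →
             InJ′ c
    decode (i , lo , i<n/2 , which) = column which
      where
      m<i : m < i
      m<i = subst (_≤ i) (trans (cong (_+ 1) n/4≡m) (+-comm m 1)) lo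
      i<2m : i < 2 * m
      i<2m = subst (i <_) n/2≡2m i<n/2
      column : ∀ {c} → OneOf₃ c (entry (m * 4) i (3 * i)) (entry (m * 4) i (3 * i + 1)) (entry (m * 4) i (3 * i + 2)) →
               InJ′ c
      column (inj₁ refl)        = subst (λ v → InJ′ (entry (m * 4) i v)) (+-identityʳ (3 * i))
                                    (band₃-entry i 0 m<i i<2m (s≤s z≤n))
      column (inj₂ (inj₁ refl)) = band₃-entry i 1 m<i i<2m (s≤s (s≤s z≤n))
      column (inj₂ (inj₂ refl)) = band₃-entry i 2 m<i i<2m (s≤s (s≤s (s≤s z≤n)))

  J₄⇒InJ : ∀ {c} → c ∈ J₄ (m * 4) → InJ′ c
  J₄⇒InJ c∈ = decode (∈-Block⁻ 0<n c∈)
    where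
    decode : ∀ {c} → Σ[ i ∈ ℕ ] (m * 4) / 2 ≤ i × i < m * 4 ×
               OneOf₃ c (entry (m * 4) i (i ∸ (m * 4) / 2 + 1)) (entry (m * 4) i i) (entry (m * 4) i (i + 1)) →
             InJ′ c
    decode (i , n/2≤i , i<n , which) = column which
      where
      2m≤i = subst (_≤ i) n/2≡2m n/2≤i
      successor : Dec (i + 1 < m * 4) → InJ′ (entry (m * 4) i (i + 1))
      successor (yes i+1<n) = settle InJ i<n i+1<n (inj₂ (inj₂ (next i 2m≤i i+1<n)))
      successor (no i+1≮n)  = subst₂ InJ (sym (m<n⇒m%n≡m i<n)) (sym (trans (cong (_% (m * 4)) i+1≡n) (n%n≡0 (m * 4))))
                                (inj₂ (inj₂ (next-wrap i i+1≡n)))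
        where
        i+1≡n : i + 1 ≡ m * 4
        i+1≡n = ≤-antisym (subst (_≤ m * 4) (+-comm 1 i) i<n) (≮⇒≥ i+1≮n)
      column : ∀ {c} → OneOf₃ c (entry (m * 4) i (i ∸ (m * 4) / 2 + 1)) (entry (m * 4) i i) (entry (m * 4) i (i + 1)) →
               InJ′ c
      column (inj₁ refl)        = subst (λ t → InJ′ (entry (m * 4) i (i ∸ t + 1))) (sym n/2≡2m)
        (settle InJ i<n (≤-<-trans (back-col≤2m i<n (back-column 2m≤i)) 2m<n) (inj₂ (inj₂ (back i _ 2m≤i i<n (back-column 2m≤i)))))
      column (inj₂ (inj₁ refl)) = settle InJ i<n i<n (inj₂ (inj₁ (diagonal i 2m≤i i<n)))
      column (inj₂ (inj₂ refl)) = successor (i + 1 <? m * 4)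

  J⇒InJ : ∀ {c} → c ∈ J (m * 4) → InJ′ c
  J⇒InJ c∈ = decode (∈-++₅⁻ (J₀ (m * 4)) (J₁ (m * 4)) (J₂ (m * 4)) (J₃ (m * 4)) c∈)
    where
    decode : ∀ {c} → c ∈ J₀ (m * 4) ⊎ c ∈ J₁ (m * 4) ⊎ c ∈ J₂ (m * 4) ⊎ c ∈ J₃ (m * 4) ⊎ c ∈ J₄ (m * 4) → InJ′ c
    decode (inj₁ c∈)                      = J₀⇒InJ c∈
    decode (inj₂ (inj₁ c∈))               = J₁⇒InJ c∈
    decode (inj₂ (inj₂ (inj₁ c∈)))        = J₂⇒InJ c∈
    decode (inj₂ (inj₂ (inj₂ (inj₁ c∈)))) = J₃⇒InJ c∈
    decode (inj₂ (inj₂ (inj₂ (inj₂ c∈)))) = J₄⇒InJ c∈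

  J₁-entry : ∀ i k → 1 ≤ i → i < m → k < 3 → entry (m * 4) i (3 * i + (2 + k)) ∈ J₁ (m * 4)
  J₁-entry i k 1≤i i<m k<3 = ∈-Block⁺ i 1≤i (subst (i <_) (sym n/4≡m) i<m) (which k<3)
    where
    which : ∀ {k} → k < 3 → OneOf₃ (entry (m * 4) i (3 * i + (2 + k)))
              (entry (m * 4) i (3 * i + 2)) (entry (m * 4) i (3 * i + 3)) (entry (m * 4) i (3 * i + 4))
    which (s≤s z≤n)             = inj₁ refl
    which (s≤s (s≤s z≤n))       = inj₂ (inj₁ refl)
    which (s≤s (s≤s (s≤s z≤n))) = inj₂ (inj₂ refl)

  J₃-entry : ∀ i k → m < i → i < 2 * m → k < 3 → entry (m * 4) i (3 * i + k) ∈ J₃ (m * 4)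
  J₃-entry i k m<i i<2m k<3 =
    ∈-Block⁺ i (subst (_≤ i) (sym (trans (cong (_+ 1) n/4≡m) (+-comm m 1))) m<i) (subst (i <_) (sym n/2≡2m) i<2m)
      (which k<3)
    where
    which : ∀ {k} → k < 3 → OneOf₃ (entry (m * 4) i (3 * i + k))
              (entry (m * 4) i (3 * i)) (entry (m * 4) i (3 * i + 1)) (entry (m * 4) i (3 * i + 2))
    which (s≤s z≤n)             = inj₁ (cong (entry (m * 4) i) (+-identityʳ (3 * i)))
    which (s≤s (s≤s z≤n))       = inj₂ (inj₁ refl)
    which (s≤s (s≤s (s≤s z≤n))) = inj₂ (inj₂ refl)

  J₄-entry : ∀ i → 2 * m ≤ i → i < m * 4 → ∀ {c} →
             OneOf₃ c (entry (m * 4) i (i ∸ 2 * m + 1)) (entry (m * 4) i i) (entry (m * 4) i (i + 1)) →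
             c ∈ J₄ (m * 4)
  J₄-entry i 2m≤i i<n {c} which =
    ∈-Block⁺ i (subst (_≤ i) (sym n/2≡2m) 2m≤i) i<n
      (subst (λ t → OneOf₃ c (entry (m * 4) i (i ∸ t + 1)) (entry (m * 4) i i) (entry (m * 4) i (i + 1)))
             (sym n/2≡2m) which)

  J₀⊆J : ∀ {c} → c ∈ J₀ (m * 4) → c ∈ J (m * 4)
  J₀⊆J c∈ = ∈-++⁺ˡ c∈
  J₁⊆J : ∀ {c} → c ∈ J₁ (m * 4) → c ∈ J (m * 4)
  J₁⊆J c∈ = ∈-++⁺ʳ (J₀ (m * 4)) (∈-++⁺ˡ c∈)
  J₂⊆J : ∀ {c} → c ∈ J₂ (m * 4) → c ∈ J (m * 4)
  J₂⊆J c∈ = ∈-++⁺ʳ (J₀ (m * 4)) (∈-++⁺ʳ (J₁ (m * 4)) (∈-++⁺ˡ c∈))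
  J₃⊆J : ∀ {c} → c ∈ J₃ (m * 4) → c ∈ J (m * 4)
  J₃⊆J c∈ = ∈-++⁺ʳ (J₀ (m * 4)) (∈-++⁺ʳ (J₁ (m * 4)) (∈-++⁺ʳ (J₂ (m * 4)) (∈-++⁺ˡ c∈)))
  J₄⊆J : ∀ {c} → c ∈ J₄ (m * 4) → c ∈ J (m * 4)
  J₄⊆J c∈ = ∈-++⁺ʳ (J₀ (m * 4)) (∈-++⁺ʳ (J₁ (m * 4)) (∈-++⁺ʳ (J₂ (m * 4)) (∈-++⁺ʳ (J₃ (m * 4)) c∈)))

  InJ⇒J : ∀ {x y} → InJ x y → (x , y) ∈ J (m * 4)
  InJ⇒J (inj₁ (row₀ k k<5)) = J₀⊆J
    (subst (_∈ J₀ (m * 4)) (entry≡ 0<n (<5⇒<n k<5)) (∈-map⁺ (entry (m * 4) 0) (∈-upTo⁺ k<5)))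
  InJ⇒J (inj₁ (band₁ i k 1≤i i<m k<3)) = J₁⊆J
    (subst (_∈ J₁ (m * 4)) (entry≡ (<2m⇒<n (<m⇒<2m i<m)) (band₁<n i<m k<3)) (J₁-entry i k 1≤i i<m k<3))
  InJ⇒J (inj₁ row-m) = J₂⊆J (here (sym
    (subst (λ t → entry (m * 4) t (3 * t + 2) ≡ (m , 3 * m + 2)) (sym n/4≡m) (entry≡ (<2m⇒<n m<2m) row-m<n))))
  InJ⇒J (inj₁ (band₃ i k m<i i<2m k<3 v<n)) = J₃⊆J
    (subst (_∈ J₃ (m * 4)) (entry≡ (<2m⇒<n i<2m) v<n) (J₃-entry i k m<i i<2m k<3))
  InJ⇒J (inj₂ (inj₁ (band₃-wrap i k y m<i i<2m k<3 y+n))) = J₃⊆J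
    (subst (_∈ J₃ (m * 4)) (cong₂ _,_ (m<n⇒m%n≡m (<2m⇒<n i<2m)) (%-wrap y+n (<2m⇒<n (wrap-col<2m i<2m k<3 y+n))))
           (J₃-entry i k m<i i<2m k<3))
  InJ⇒J (inj₂ (inj₁ (diagonal i 2m≤i i<n))) = J₄⊆J
    (J₄-entry i 2m≤i i<n (inj₂ (inj₁ (sym (entry≡ i<n i<n)))))
  InJ⇒J (inj₂ (inj₂ (back i y 2m≤i i<n y+2m))) = J₄⊆J
    (J₄-entry i 2m≤i i<n (inj₁ (sym (trans (cong (entry (m * 4) i) y≡) (entry≡ i<n (≤-<-trans (back-col≤2m i<n y+2m) 2m<n))))))
    where
    y≡ : i ∸ 2 * m + 1 ≡ y
    y≡ = +-cancelʳ-≡ (2 * m) _ y (trans (back-column 2m≤i) (sym y+2m))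
  InJ⇒J (inj₂ (inj₂ (next i 2m≤i i+1<n))) = J₄⊆J
    (J₄-entry i 2m≤i i<n (inj₂ (inj₂ (sym (entry≡ i<n i+1<n)))))
    where
    i<n : i < m * 4
    i<n = <-trans (m<m+n i z<s) i+1<n
  InJ⇒J (inj₂ (inj₂ (next-wrap i i+1≡n))) = J₄⊆J
    (J₄-entry i 2m≤i i<n (inj₂ (inj₂ (sym (cong₂ _,_ (m<n⇒m%n≡m i<n)
                                              (trans (cong (_% (m * 4)) i+1≡n) (n%n≡0 (m * 4))))))))
    where
    i<n : i < m * 4
    i<n = subst (i <_) i+1≡n (m<m+n i z<s)
    2m≤i : 2 * m ≤ i
    2m≤i = ≤-by (m + 2) (+-mono-≤ (≤-reflexive (sym i+1≡n)) 3≤m) (solve (i ∷ m ∷ []))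

  T₁-row : ∀ {x y} → T₁ x y → x < 2 * m
  T₁-row (row₀ k k<5)                = <-trans 0<m m<2m
  T₁-row (band₁ i k 1≤i i<m k<3)     = <m⇒<2m i<m
  T₁-row row-m                       = m<2m
  T₁-row (band₃ i k m<i i<2m k<3 _)  = i<2m

  T₂-row : ∀ {x y} → T₂ x y → m < x
  T₂-row (band₃-wrap i k y m<i i<2m k<3 _) = m<i
  T₂-row (diagonal i 2m≤i i<n)             = <-≤-trans m<2m 2m≤i

  T₃-row : ∀ {x y} → T₃ x y → 2 * m ≤ x
  T₃-row (back i y 2m≤i i<n _)  = 2m≤i
  T₃-row (next i 2m≤i i+1<n)    = 2m≤i
  T₃-row (next-wrap i i+1≡n)    = ≤-by (m + 2) (+-mono-≤ (≤-reflexive (sym i+1≡n)) 3≤m) (solve (i ∷ m ∷ []))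

  InJ-row<n : ∀ {x y} → InJ x y → x < m * 4
  InJ-row<n (inj₁ t)                                 = <2m⇒<n (T₁-row t)
  InJ-row<n (inj₂ (inj₁ (band₃-wrap i k y m<i i<2m k<3 _))) = <2m⇒<n i<2m
  InJ-row<n (inj₂ (inj₁ (diagonal i 2m≤i i<n)))      = i<n
  InJ-row<n (inj₂ (inj₂ (back i y 2m≤i i<n _)))      = i<n
  InJ-row<n (inj₂ (inj₂ (next i 2m≤i i+1<n)))        = <-trans (m<m+n i z<s) i+1<n
  InJ-row<n (inj₂ (inj₂ (next-wrap i i+1≡n)))        = subst (i <_) i+1≡n (m<m+n i z<s)

  InJ-col<n : ∀ {x y} → InJ x y → y < m * 4
  InJ-col<n (inj₁ (row₀ k k<5))                      = <5⇒<n k<5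
  InJ-col<n (inj₁ (band₁ i k 1≤i i<m k<3))           = band₁<n i<m k<3
  InJ-col<n (inj₁ row-m)                             = row-m<n
  InJ-col<n (inj₁ (band₃ i k m<i i<2m k<3 v<n))      = v<n
  InJ-col<n (inj₂ (inj₁ (band₃-wrap i k y m<i i<2m k<3 y+n))) = <2m⇒<n (wrap-col<2m i<2m k<3 y+n)
  InJ-col<n (inj₂ (inj₁ (diagonal i 2m≤i i<n)))      = i<n
  InJ-col<n (inj₂ (inj₂ (back i y 2m≤i i<n y+2m)))   = ≤-<-trans (back-col≤2m i<n y+2m) 2m<n
  InJ-col<n (inj₂ (inj₂ (next i 2m≤i i+1<n)))        = i+1<n
  InJ-col<n (inj₂ (inj₂ (next-wrap i i+1≡n)))        = 0<n

  -- Rows.  The entries of J in row r are counted by listing their columns.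
  row-count : ∀ r (W : List ℕ) → Unique W → (∀ {y} → y ∈ W → InJ r y) →
              (∀ {x y} → InJ x y → x ≡ r → y ∈ W) → rowCount (m * 4) r ≡ length W
  row-count r W uW sound complete =
    count-exactly (λ y → (r , y) ∈? J (m * 4)) (Unique.upTo⁺ (m * 4)) uW
      (λ y∈W → ∈-upTo⁺ (InJ-col<n (sound y∈W)) , InJ⇒J (sound y∈W))
      (λ _ r,y∈J → complete (J⇒InJ r,y∈J) refl)

  row-0 : rowCount (m * 4) 0 ≡ 5
  row-0 = row-count 0 (upTo 5) (Unique.upTo⁺ 5) (λ y∈ → inj₁ (row₀ _ (∈-upTo⁻ y∈))) complete
    where
    complete : ∀ {x y} → InJ x y → x ≡ 0 → y ∈ upTo 5
    complete (inj₁ (row₀ k k<5))                 _    = ∈-upTo⁺ k<5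
    complete (inj₁ (band₁ i k 1≤i i<m k<3))      refl = ⊥-elim (<-irrefl refl 1≤i)
    complete (inj₁ row-m)                        m≡0  = ⊥-elim (<-irrefl (sym m≡0) 0<m)
    complete (inj₁ (band₃ i k m<i i<2m k<3 _))   refl = ⊥-elim (n≮0 m<i)
    complete (inj₂ (inj₁ t))                     refl = ⊥-elim (n≮0 (T₂-row t))
    complete (inj₂ (inj₂ t))                     refl = ⊥-elim (n≮0 (<-≤-trans (<-trans 0<m m<2m) (T₃-row t)))

  row-m-count : rowCount (m * 4) m ≡ 1
  row-m-count = row-count m (3 * m + 2 ∷ []) (All.[] AllPairs.∷ AllPairs.[]) (λ { (here refl) → inj₁ row-m }) complete
    where
    complete : ∀ {x y} → InJ x y → x ≡ m → y ∈ 3 * m + 2 ∷ []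
    complete (inj₁ (row₀ k k<5))                 0≡m  = ⊥-elim (<-irrefl 0≡m 0<m)
    complete (inj₁ (band₁ i k 1≤i i<m k<3))      refl = ⊥-elim (<-irrefl refl i<m)
    complete (inj₁ row-m)                        _    = here refl
    complete (inj₁ (band₃ i k m<i i<2m k<3 _))   refl = ⊥-elim (<-irrefl refl m<i)
    complete (inj₂ (inj₁ t))                     refl = ⊥-elim (<-irrefl refl (T₂-row t))
    complete (inj₂ (inj₂ t))                     refl = ⊥-elim (<⇒≱ m<2m (T₃-row t))

  row-n/4 : rowCount (m * 4) ((m * 4) / 4) ≡ 1
  row-n/4 = subst (λ r → rowCount (m * 4) r ≡ 1) (sym n/4≡m) row-m-count

  row-band₁ : ∀ r → 1 ≤ r → r < m → rowCount (m * 4) r ≡ 3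
  row-band₁ r 1≤r r<m = row-count r W (unique₃ (shift (λ ())) (shift (λ ())) (shift (λ ()))) sound complete
    where
    W : List ℕ
    W = 3 * r + 2 ∷ 3 * r + 3 ∷ 3 * r + 4 ∷ []
    shift : ∀ {a b} → a ≢ b → 3 * r + a ≢ 3 * r + b
    shift a≢b eq = a≢b (+-cancelˡ-≡ (3 * r) _ _ eq)
    sound : ∀ {y} → y ∈ W → InJ r y
    sound (here refl)                 = inj₁ (band₁ r 0 1≤r r<m (s≤s z≤n))
    sound (there (here refl))         = inj₁ (band₁ r 1 1≤r r<m (s≤s (s≤s z≤n)))
    sound (there (there (here refl))) = inj₁ (band₁ r 2 1≤r r<m (s≤s (s≤s (s≤s z≤n))))
    complete : ∀ {x y} → InJ x y → x ≡ r → y ∈ W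
    complete (inj₁ (row₀ k k<5))                           0≡r  = ⊥-elim (<-irrefl 0≡r 1≤r)
    complete (inj₁ (band₁ i k 1≤i i<m (s≤s z≤n)))             refl = here refl
    complete (inj₁ (band₁ i k 1≤i i<m (s≤s (s≤s z≤n))))       refl = there (here refl)
    complete (inj₁ (band₁ i k 1≤i i<m (s≤s (s≤s (s≤s z≤n))))) refl = there (there (here refl))
    complete (inj₁ row-m)                                  m≡r  = ⊥-elim (<-irrefl (sym m≡r) r<m)
    complete (inj₁ (band₃ i k m<i i<2m k<3 _))             refl = ⊥-elim (<-asym m<i r<m)
    complete (inj₂ (inj₁ t))                               refl = ⊥-elim (<-asym (T₂-row t) r<m)
    complete (inj₂ (inj₂ t))                               refl = ⊥-elim (<⇒≱ (<m⇒<2m r<m) (T₃-row t))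

  row-band₃ : ∀ r → m < r → r < 2 * m → rowCount (m * 4) r ≡ 3
  row-band₃ r m<r r<2m = row-count r W unique-W sound complete
    where
    col : ℕ → ℕ
    col k = (3 * r + k) % (m * 4)
    W : List ℕ
    W = col 0 ∷ col 1 ∷ col 2 ∷ []
    distinct : ∀ a d → 0 < d → d < 3 → col (a + d) ≢ col a
    distinct a d 0<d d<3 eq =
      %-shift-≢ (3 * r + a) 0<d (<-trans d<3 (<5⇒<n (s≤s (s≤s (s≤s (s≤s z≤n))))))
        (trans (cong (_% (m * 4)) (+-assoc (3 * r) a d)) eq)
    unique-W : Unique W
    unique-W = unique₃ (λ eq → distinct 0 1 z<s (s≤s (s≤s z≤n)) (sym eq))
                       (λ eq → distinct 0 2 z<s (s≤s (s≤s (s≤s z≤n))) (sym eq))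
                       (λ eq → distinct 1 1 z<s (s≤s (s≤s z≤n)) (sym eq))
    column : ∀ k → k < 3 → InJ r (col k)
    column k k<3 = subst (λ x → InJ x (col k)) (m<n⇒m%n≡m (<2m⇒<n r<2m)) (band₃-entry r k m<r r<2m k<3)
    sound : ∀ {y} → y ∈ W → InJ r y
    sound (here refl)                 = column 0 (s≤s z≤n)
    sound (there (here refl))         = column 1 (s≤s (s≤s z≤n))
    sound (there (there (here refl))) = column 2 (s≤s (s≤s (s≤s z≤n)))
    listed : ∀ {k} → k < 3 → col k ∈ W
    listed (s≤s z≤n)             = here refl
    listed (s≤s (s≤s z≤n))       = there (here refl)
    listed (s≤s (s≤s (s≤s z≤n))) = there (there (here refl))
    complete : ∀ {x y} → InJ x y → x ≡ r → y ∈ W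
    complete (inj₁ (row₀ k k<5))                      0≡r  = ⊥-elim (n≮0 (subst (m <_) (sym 0≡r) m<r))
    complete (inj₁ (band₁ i k 1≤i i<m k<3))           refl = ⊥-elim (<-asym i<m m<r)
    complete (inj₁ row-m)                             m≡r  = ⊥-elim (<-irrefl m≡r m<r)
    complete (inj₁ (band₃ i k m<i i<2m k<3 v<n))      refl = subst (_∈ W) (m<n⇒m%n≡m v<n) (listed k<3)
    complete (inj₂ (inj₁ (band₃-wrap i k y m<i i<2m k<3 y+n))) refl =
      subst (_∈ W) (%-wrap y+n (<2m⇒<n (wrap-col<2m i<2m k<3 y+n))) (listed k<3)
    complete (inj₂ (inj₁ (diagonal i 2m≤i i<n)))     refl = ⊥-elim (<⇒≱ r<2m 2m≤i)
    complete (inj₂ (inj₂ t))                          refl = ⊥-elim (<⇒≱ r<2m (T₃-row t))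

  row-band₄ : ∀ r → 2 * m ≤ r → r < m * 4 → rowCount (m * 4) r ≡ 3
  row-band₄ r 2m≤r r<n = row-count r W (unique₃ back≢r back≢next r≢next) sound complete
    where
    W : List ℕ
    W = r ∸ 2 * m + 1 ∷ r ∷ (r + 1) % (m * 4) ∷ []
    0<r : 0 < r
    0<r = <-≤-trans (<-trans 0<m m<2m) 2m≤r
    back-col : (r ∸ 2 * m + 1) + 2 * m ≡ r + 1
    back-col = back-column 2m≤r
    back≢r : r ∸ 2 * m + 1 ≢ r
    back≢r eq = ≰-by (m + 1) (+-mono-≤ (≤-reflexive (+-cancelˡ-≡ r (2 * m) 1 (trans (cong (_+ 2 * m) (sym eq)) back-col))) 3≤m)
                  (solve (m ∷ []))
    Next : Set
    Next = (r + 1 < m * 4 × (r + 1) % (m * 4) ≡ r + 1) ⊎ (r + 1 ≡ m * 4 × (r + 1) % (m * 4) ≡ 0)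
    back≢next′ : Next → r ∸ 2 * m + 1 ≢ (r + 1) % (m * 4)
    back≢next′ (inj₁ (_ , r+1%n)) eq =
      ≰-by (m + 2) (+-mono-≤ (≤-reflexive (+-cancelˡ-≡ (r + 1) (2 * m) 0 r+1+2m≡r+1)) 3≤m) (solve (m ∷ []))
      where
      r+1+2m≡r+1 : r + 1 + 2 * m ≡ r + 1 + 0
      r+1+2m≡r+1 = trans (cong (_+ 2 * m) (sym (trans eq r+1%n))) (trans back-col (sym (+-identityʳ (r + 1))))
    back≢next′ (inj₂ (_ , r+1%n)) eq = 1+n≢0 (trans (+-comm 1 (r ∸ 2 * m)) (trans eq r+1%n))
    back≢next : r ∸ 2 * m + 1 ≢ (r + 1) % (m * 4)
    back≢next = back≢next′ (%-suc r<n)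
    r≢next′ : Next → r ≢ (r + 1) % (m * 4)
    r≢next′ (inj₁ (_ , r+1%n)) eq = <-irrefl (trans eq r+1%n) (m<m+n r z<s)
    r≢next′ (inj₂ (_ , r+1%n)) eq = <-irrefl (sym (trans eq r+1%n)) 0<r
    r≢next : r ≢ (r + 1) % (m * 4)
    r≢next = r≢next′ (%-suc r<n)
    next-col : Next → InJ r ((r + 1) % (m * 4))
    next-col (inj₁ (r+1<n , r+1%n)) = subst (InJ r) (sym r+1%n) (inj₂ (inj₂ (next r 2m≤r r+1<n)))
    next-col (inj₂ (r+1≡n , r+1%n)) = subst (InJ r) (sym r+1%n) (inj₂ (inj₂ (next-wrap r r+1≡n)))
    sound : ∀ {y} → y ∈ W → InJ r y
    sound (here refl)                 = inj₂ (inj₂ (back r _ 2m≤r r<n back-col))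
    sound (there (here refl))         = inj₂ (inj₁ (diagonal r 2m≤r r<n))
    sound (there (there (here refl))) = next-col (%-suc r<n)
    complete : ∀ {x y} → InJ x y → x ≡ r → y ∈ W
    complete (inj₁ t)                                  refl = ⊥-elim (<⇒≱ (T₁-row t) 2m≤r)
    complete (inj₂ (inj₁ (band₃-wrap i k y m<i i<2m k<3 _))) refl = ⊥-elim (<⇒≱ i<2m 2m≤r)
    complete (inj₂ (inj₁ (diagonal i 2m≤i i<n)))      refl = there (here refl)
    complete (inj₂ (inj₂ (back i y 2m≤i i<n y+2m)))   refl =
      here (+-cancelʳ-≡ (2 * m) y _ (trans y+2m (sym back-col)))
    complete (inj₂ (inj₂ (next i 2m≤i i+1<n)))        refl = there (there (here (sym (m<n⇒m%n≡m i+1<n))))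
    complete (inj₂ (inj₂ (next-wrap i i+1≡n)))        refl =
      there (there (here (sym (trans (cong (_% (m * 4)) i+1≡n) (n%n≡0 (m * 4))))))

  row-other : ∀ r → r < m * 4 → r ≢ 0 → r ≢ m → rowCount (m * 4) r ≡ 3
  row-other r r<n r≢0 r≢m = by-position (<-cmp r m)
    where
    by-position : Tri (r < m) (r ≡ m) (m < r) → rowCount (m * 4) r ≡ 3
    by-position (tri< r<m _ _) = row-band₁ r (n≢0⇒n>0 r≢0) r<m
    by-position (tri≈ _ r≡m _) = ⊥-elim (r≢m r≡m)
    by-position (tri> _ _ m<r) = above-m (r <? 2 * m)
      where
      above-m : Dec (r < 2 * m) → rowCount (m * 4) r ≡ 3
      above-m (yes r<2m) = row-band₃ r m<r r<2m
      above-m (no r≮2m)  = row-band₄ r (≮⇒≥ r≮2m) r<n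

  -- Columns.  Each family T₁, T₂, T₃ meets every column in exactly one cell,
  -- and the three cells in a column lie in different rows.

  band₁-col≥5 : ∀ {i k} → 1 ≤ i → 5 ≤ 3 * i + (2 + k)
  band₁-col≥5 {i} {k} 1≤i = ≤-by k (scale 3 1≤i) (solve (i ∷ k ∷ []))

  band₁-col<3m+2 : ∀ {i k} → i < m → k < 3 → 3 * i + (2 + k) < 3 * m + 2
  band₁-col<3m+2 {i} {k} i<m k<3 = ≤-by 0 (+-mono-≤ (scale 3 i<m) k<3) (solve (i ∷ k ∷ m ∷ []))

  band₃-col>3m+2 : ∀ {i k} → m < i → 3 * m + 2 < 3 * i + k
  band₃-col>3m+2 {i} {k} m<i = ≤-by k (scale 3 m<i) (solve (i ∷ k ∷ m ∷ []))

  5≤3m+2 : 5 ≤ 3 * m + 2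
  5≤3m+2 = ≤-by (2 * m) 3≤m (solve (m ∷ []))

  T₁-unique : ∀ {x c x′ c′} → T₁ x c → T₁ x′ c′ → c ≡ c′ → x ≡ x′
  T₁-unique (row₀ _ _) (row₀ _ _) _ = refl
  T₁-unique (row₀ k k<5) (band₁ i k′ 1≤i _ _) e = ⊥-elim (<⇒≱ k<5 (subst (5 ≤_) (sym e) (band₁-col≥5 1≤i)))
  T₁-unique (row₀ k k<5) row-m e = ⊥-elim (<⇒≱ k<5 (subst (5 ≤_) (sym e) 5≤3m+2))
  T₁-unique (row₀ k k<5) (band₃ i k′ m<i _ _ _) e =
    ⊥-elim (<⇒≱ k<5 (subst (5 ≤_) (sym e) (≤-trans 5≤3m+2 (<⇒≤ (band₃-col>3m+2 m<i)))))
  T₁-unique t@(band₁ _ _ _ _ _) t′@(row₀ _ _) e = sym (T₁-unique t′ t (sym e))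
  T₁-unique (band₁ i k _ _ k<3) (band₁ i′ k′ _ _ k′<3) e =
    quotient-unique 3 k<3 k′<3 (≡-by e (solve (i ∷ k ∷ i′ ∷ k′ ∷ [])))
  T₁-unique (band₁ i k _ i<m k<3) row-m e = ⊥-elim (<⇒≢ (band₁-col<3m+2 i<m k<3) e)
  T₁-unique (band₁ i k _ i<m k<3) (band₃ i′ k′ m<i′ _ _ _) e =
    ⊥-elim (<⇒≢ (<-trans (band₁-col<3m+2 i<m k<3) (band₃-col>3m+2 m<i′)) e)
  T₁-unique t@row-m t′@(row₀ _ _) e = sym (T₁-unique t′ t (sym e))
  T₁-unique t@row-m t′@(band₁ _ _ _ _ _) e = sym (T₁-unique t′ t (sym e))
  T₁-unique row-m row-m _ = refl
  T₁-unique row-m (band₃ i′ k′ m<i′ _ _ _) e = ⊥-elim (<⇒≢ (band₃-col>3m+2 m<i′) e)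
  T₁-unique t@(band₃ _ _ _ _ _ _) t′@(row₀ _ _) e = sym (T₁-unique t′ t (sym e))
  T₁-unique t@(band₃ _ _ _ _ _ _) t′@(band₁ _ _ _ _ _) e = sym (T₁-unique t′ t (sym e))
  T₁-unique t@(band₃ _ _ _ _ _ _) t′@row-m e = sym (T₁-unique t′ t (sym e))
  T₁-unique (band₃ i k _ _ k<3 _) (band₃ i′ k′ _ _ k′<3 _) e = quotient-unique 3 k<3 k′<3 e

  T₂-unique : ∀ {x c x′ c′} → T₂ x c → T₂ x′ c′ → c ≡ c′ → x ≡ x′
  T₂-unique (band₃-wrap i k y _ _ k<3 y+n) (band₃-wrap i′ k′ y′ _ _ k′<3 y′+n) e =
    quotient-unique 3 k<3 k′<3 (trans (sym y+n) (trans (cong (_+ m * 4) e) y′+n))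
  T₂-unique (band₃-wrap i k y _ i<2m k<3 y+n) (diagonal i′ 2m≤i′ _) e =
    ⊥-elim (<⇒≱ (wrap-col<2m i<2m k<3 y+n) (subst (2 * m ≤_) (sym e) 2m≤i′))
  T₂-unique t@(diagonal _ _ _) t′@(band₃-wrap _ _ _ _ _ _ _) e = sym (T₂-unique t′ t (sym e))
  T₂-unique (diagonal _ _ _) (diagonal _ _ _) e = e

  T₃-unique : ∀ {x c x′ c′} → T₃ x c → T₃ x′ c′ → c ≡ c′ → x ≡ x′
  T₃-unique (back i y _ _ y+2m) (back i′ y′ _ _ y′+2m) e =
    +-cancelʳ-≡ 1 i i′ (trans (sym y+2m) (trans (cong (_+ 2 * m) e) y′+2m))
  T₃-unique (back i y _ i<n y+2m) (next i′ 2m≤i′ _) e =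
    ⊥-elim (<⇒≱ (subst (2 * m <_) (+-comm 1 i′) (s≤s 2m≤i′)) (subst (_≤ 2 * m) e (back-col≤2m i<n y+2m)))
  T₃-unique (back i y 2m≤i _ y+2m) (next-wrap i′ _) e = ⊥-elim (<⇒≢ (subst (0 <_) e (back-col≥1 2m≤i y+2m)) refl)
  T₃-unique t@(next _ _ _) t′@(back _ _ _ _ _) e = sym (T₃-unique t′ t (sym e))
  T₃-unique (next i _ _) (next i′ _ _) e = +-cancelʳ-≡ 1 i i′ e
  T₃-unique (next i _ _) (next-wrap i′ _) e = ⊥-elim (1+n≢0 (trans (+-comm 1 i) e))
  T₃-unique t@(next-wrap _ _) t′@(back _ _ _ _ _) e = sym (T₃-unique t′ t (sym e))
  T₃-unique t@(next-wrap _ _) t′@(next _ _ _) e = sym (T₃-unique t′ t (sym e))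
  T₃-unique (next-wrap i i+1≡n) (next-wrap i′ i′+1≡n) _ = +-cancelʳ-≡ 1 i i′ (trans i+1≡n (sym i′+1≡n))

  T₁-exists : ∀ c → c < m * 4 → Σ[ x ∈ ℕ ] T₁ x c
  T₁-exists c c<n with c <? 5 | c <? 3 * m + 2 | c ≟ 3 * m + 2
  ... | yes c<5 | _ | _ = 0 , row₀ c c<5
  ... | no c≮5 | yes c<3m+2 | _ = in-band₁ (divide 3 (c ∸ 2))
    where
    2+[c∸2]≡c : 2 + (c ∸ 2) ≡ c
    2+[c∸2]≡c = m+[n∸m]≡n (≤-trans (s≤s (s≤s z≤n)) (≮⇒≥ c≮5))
    in-band₁ : Σ[ q ∈ ℕ ] Σ[ r ∈ ℕ ] r < 3 × c ∸ 2 ≡ 3 * q + r → Σ[ x ∈ ℕ ] T₁ x c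
    in-band₁ (q , r , r<3 , eq) = q , subst (T₁ q) c≡ (band₁ q r 1≤q q<m r<3)
      where
      c≡ : 3 * q + (2 + r) ≡ c
      c≡ = trans shift (trans (cong (2 +_) (sym eq)) 2+[c∸2]≡c)
        where
        shift : 3 * q + (2 + r) ≡ 2 + (3 * q + r)
        shift = solve (q ∷ r ∷ [])
      1≤q : 1 ≤ q
      1≤q = quotient-≥ 3 r<3 (subst (3 ≤_) eq (m+n≤o⇒m≤o∸n 3 (≮⇒≥ c≮5)))
      q<m : q < m
      q<m = quotient-< 3 (subst (_< 3 * m) eq (subst (c ∸ 2 <_) (m+n∸n≡m (3 * m) 2)
              (∸-monoˡ-< c<3m+2 (≤-trans (s≤s (s≤s z≤n)) (≮⇒≥ c≮5)))))
  ... | no _ | no _ | yes c≡3m+2 = m , subst (T₁ m) (sym c≡3m+2) row-m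
  ... | no _ | no c≮3m+2 | no c≢3m+2 = in-band₃ (divide 3 c)
    where
    3[m+1]≤c : 3 * suc m ≤ c
    3[m+1]≤c = subst (_≤ c) 3m+3≡3[m+1] (≤∧≢⇒< (≮⇒≥ c≮3m+2) (≢-sym c≢3m+2))
      where
      3m+3≡3[m+1] : suc (3 * m + 2) ≡ 3 * suc m
      3m+3≡3[m+1] = solve (m ∷ [])
    in-band₃ : Σ[ q ∈ ℕ ] Σ[ r ∈ ℕ ] r < 3 × c ≡ 3 * q + r → Σ[ x ∈ ℕ ] T₁ x c
    in-band₃ (q , r , r<3 , eq) = q , subst (T₁ q) (sym eq) (band₃ q r m<q q<2m r<3 (subst (_< m * 4) eq c<n))
      where
      m<q : m < q
      m<q = quotient-≥ 3 r<3 (subst (3 * suc m ≤_) eq 3[m+1]≤c)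
      q<2m : q < 2 * m
      q<2m = quotient-< 3 (subst (_< 3 * (2 * m)) eq (<-≤-trans c<n n≤6m))
        where
        n≤6m : m * 4 ≤ 3 * (2 * m)
        n≤6m = ≤-by (2 * m) (≤-refl {0}) (solve (m ∷ []))

  T₂-exists : ∀ c → c < m * 4 → Σ[ x ∈ ℕ ] T₂ x c
  T₂-exists c c<n with c <? 2 * m
  ... | no c≮2m = c , diagonal c (≮⇒≥ c≮2m) c<n
  ... | yes c<2m = in-band₃ (divide 3 (c + m * 4))
    where
    in-band₃ : Σ[ q ∈ ℕ ] Σ[ r ∈ ℕ ] r < 3 × c + m * 4 ≡ 3 * q + r → Σ[ x ∈ ℕ ] T₂ x c
    in-band₃ (q , r , r<3 , eq) = q , band₃-wrap q r c m<q q<2m r<3 eq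
      where
      m<q : m < q
      m<q = quotient-≥ 3 r<3 (subst (3 * suc m ≤_) eq (≤-by c 3≤m (solve (c ∷ m ∷ []))))
      q<2m : q < 2 * m
      q<2m = quotient-< 3 (subst (_< 3 * (2 * m)) eq (≤-by 0 c<2m (solve (c ∷ m ∷ []))))

  T₃-exists : ∀ c → c < m * 4 → Σ[ x ∈ ℕ ] T₃ x c
  T₃-exists zero    _   = m * 4 ∸ 1 , next-wrap (m * 4 ∸ 1) (m∸n+n≡m 0<n)
  T₃-exists (suc c) c<n with suc c ≤? 2 * m
  ... | yes c<2m = c + 2 * m , back (c + 2 * m) (suc c) (m≤n+m (2 * m) c) (≤-by 0 c<2m (solve (c ∷ m ∷ [])))
                                  (solve (c ∷ m ∷ []))
  ... | no c≮2m  = c , subst (T₃ c) (+-comm c 1) (next c (<⇒≤pred (≰⇒> c≮2m)) (subst (_< m * 4) (+-comm 1 c) c<n))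

  T₁≢T₃ : ∀ {x c x′ c′} → T₁ x c → T₃ x′ c′ → x ≢ x′
  T₁≢T₃ t₁ t₃ refl = <⇒≱ (T₁-row t₁) (T₃-row t₃)

  T₁≢T₂ : ∀ {x c x′ c′} → T₁ x c → T₂ x′ c′ → c ≡ c′ → x ≢ x′
  T₁≢T₂ (row₀ _ _)                 t₂ _ refl = n≮0 (T₂-row t₂)
  T₁≢T₂ (band₁ i _ _ i<m _)        t₂ _ refl = <-asym i<m (T₂-row t₂)
  T₁≢T₂ row-m                      t₂ _ refl = <-irrefl refl (T₂-row t₂)
  T₁≢T₂ (band₃ i k m<i _ _ _) (band₃-wrap i′ k′ y _ i′<2m k′<3 y+n) e _ =
    <⇒≢ (<-≤-trans (wrap-col<2m i′<2m k′<3 y+n) (≤-trans 2m≤3m+2 (<⇒≤ (band₃-col>3m+2 m<i)))) (sym e)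
    where
    2m≤3m+2 : 2 * m ≤ 3 * m + 2
    2m≤3m+2 = ≤-by (m + 2) (≤-refl {0}) (solve (m ∷ []))
  T₁≢T₂ (band₃ i _ _ i<2m _ _)     (diagonal _ 2m≤i _) _ refl = <⇒≱ i<2m 2m≤i

  T₂≢T₃ : ∀ {x c x′ c′} → T₂ x c → T₃ x′ c′ → c ≡ c′ → x ≢ x′
  T₂≢T₃ (band₃-wrap i _ _ _ i<2m _ _) t₃ _ refl = <⇒≱ i<2m (T₃-row t₃)
  T₂≢T₃ (diagonal i _ _) (back _ y _ _ y+2m) refl refl =
    ≰-by (m + 1) (+-mono-≤ (≤-reflexive (+-cancelˡ-≡ i (2 * m) 1 y+2m)) 3≤m) (solve (m ∷ []))
  T₂≢T₃ (diagonal i _ _) (next _ _ _) i≡i+1 refl = <-irrefl i≡i+1 (m<m+n i z<s)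
  T₂≢T₃ (diagonal i 2m≤i _) (next-wrap _ _) i≡0 refl =
    <-irrefl (sym i≡0) (<-≤-trans (<-trans 0<m m<2m) 2m≤i)

  column-count : ∀ c → c < m * 4 → colCount (m * 4) c ≡ 3
  column-count c c<n = from-witnesses (T₁-exists c c<n) (T₂-exists c c<n) (T₃-exists c c<n)
    where
    from-witnesses : Σ[ x ∈ ℕ ] T₁ x c → Σ[ x ∈ ℕ ] T₂ x c → Σ[ x ∈ ℕ ] T₃ x c → colCount (m * 4) c ≡ 3
    from-witnesses (x₁ , t₁) (x₂ , t₂) (x₃ , t₃) =
      count-exactly (λ x → (x , c) ∈? J (m * 4)) (Unique.upTo⁺ (m * 4))
        (unique₃ (T₁≢T₂ t₁ t₂ refl) (T₁≢T₃ t₁ t₃) (T₂≢T₃ t₂ t₃ refl)) sound complete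
      where
      W : List ℕ
      W = x₁ ∷ x₂ ∷ x₃ ∷ []
      described : ∀ {x} → x ∈ W → InJ x c
      described (here refl)                 = inj₁ t₁
      described (there (here refl))         = inj₂ (inj₁ t₂)
      described (there (there (here refl))) = inj₂ (inj₂ t₃)
      sound : ∀ {x} → x ∈ W → x ∈ upTo (m * 4) × (x , c) ∈ J (m * 4)
      sound x∈W = ∈-upTo⁺ (InJ-row<n (described x∈W)) , InJ⇒J (described x∈W)
      locate : ∀ {x} → InJ x c → x ∈ W
      locate (inj₁ t)        = here (T₁-unique t t₁ refl)
      locate (inj₂ (inj₁ t)) = there (here (T₂-unique t t₂ refl))
      locate (inj₂ (inj₂ t)) = there (there (here (T₃-unique t t₃ refl)))
      complete : ∀ {x} → x ∈ upTo (m * 4) → (x , c) ∈ J (m * 4) → x ∈ W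
      complete _ x,c∈J = locate (J⇒InJ x,c∈J)

  -- Symbols.  Three further
  -- families S₁, S₂, S₃, indexed by cell and symbol, split J again so that
  -- each family contains every symbol exactly once; each constructor records
  -- the symbol as an explicit linear equation.

  -- The diagonal and the successor cells of J₄ (even and odd symbols).
  data S₁ : ℕ → ℕ → ℕ → Set where
    diagonal  : ∀ i s → 2 * m ≤ i → i < m * 4 → i + i ≡ s + m * 4 → s < m * 4 → S₁ i i s
    next      : ∀ i s → 2 * m ≤ i → i + 1 < m * 4 → i + (i + 1) ≡ s + m * 4 → s < m * 4 → S₁ i (i + 1) s
    next-wrap : ∀ i → i + 1 ≡ m * 4 → S₁ i 0 i

  -- Row 0 without (0, 0), the band of J₁, and the middle column of J₃.
  data S₂ : ℕ → ℕ → ℕ → Set where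
    row₀       : ∀ k → 1 ≤ k → k < 5 → S₂ 0 k k
    band₁      : ∀ i k → 1 ≤ i → i < m → k < 3 → i + (3 * i + (2 + k)) < m * 4 →
                 S₂ i (3 * i + (2 + k)) (i + (3 * i + (2 + k)))
    band₁-wrap : ∀ i → i + 1 ≡ m → S₂ i (3 * i + 4) 0
    band₃      : ∀ i y s → m < i → i < 2 * m → Residue (m * 4) (3 * i + 1) y →
                 4 * i + 1 ≡ s + m * 4 → s < m * 4 → S₂ i y s

  -- The cells (0, 0) and (m, 3m + 2), the outer columns of J₃, and the
  -- remaining cells (i, i - 2m + 1) of J₄.
  data S₃ : ℕ → ℕ → ℕ → Set where
    origin : S₃ 0 0 0
    row-m  : S₃ m (3 * m + 2) 2
    band₃  : ∀ i k y s → k ≡ 0 ⊎ k ≡ 2 → m < i → i < 2 * m → Residue (m * 4) (3 * i + k) y →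
             4 * i + k ≡ s + m * 4 → s < m * 4 → S₃ i y s
    back   : ∀ i y s → 2 * m ≤ i → i < m * 4 → y + 2 * m ≡ i + 1 →
             i + y ≡ s ⊎ i + y ≡ s + m * 4 → s < m * 4 → S₃ i y s

  Carries : ℕ → ℕ → ℕ → Set
  Carries x y s = InJ x y × (x + y) % (m * 4) ≡ s

  residue-InJ : ∀ {i k y} → m < i → i < 2 * m → k < 3 → Residue (m * 4) (3 * i + k) y → InJ i y
  residue-InJ m<i i<2m k<3 (inj₁ (refl , v<n)) = inj₁ (band₃ _ _ m<i i<2m k<3 v<n)
  residue-InJ m<i i<2m k<3 (inj₂ (y+n , _))    = inj₂ (inj₁ (band₃-wrap _ _ _ m<i i<2m k<3 y+n))

  4i+k : ∀ i k → i + (3 * i + k) ≡ 4 * i + k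
  4i+k = solve-∀

  residue-symbol : ∀ {i k y s} → Residue (m * 4) (3 * i + k) y → 4 * i + k ≡ s + m * 4 → s < m * 4 →
                   (i + y) % (m * 4) ≡ s
  residue-symbol {i} {k} (inj₁ (refl , _)) eq s<n = %-wrap (sym (trans (4i+k i k) eq)) s<n
  residue-symbol {i} {k} {y} {s} (inj₂ (y+n , _)) eq s<n = trans (cong (_% (m * 4)) i+y≡s) (m<n⇒m%n≡m s<n)
    where
    i+y≡s : i + y ≡ s
    i+y≡s = +-cancelʳ-≡ (m * 4) (i + y) s (trans (+-assoc i y (m * 4)) (trans (cong (i +_) y+n) (trans (4i+k i k) eq)))

  S₁-carries : ∀ {x y s} → S₁ x y s → Carries x y s
  S₁-carries (diagonal i s 2m≤i i<n eq s<n) = inj₂ (inj₁ (diagonal i 2m≤i i<n)) , %-wrap (sym eq) s<n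
  S₁-carries (next i s 2m≤i i+1<n eq s<n)  = inj₂ (inj₂ (next i 2m≤i i+1<n)) , %-wrap (sym eq) s<n
  S₁-carries (next-wrap i i+1≡n)       = inj₂ (inj₂ (next-wrap i i+1≡n)) ,
    trans (cong (_% (m * 4)) (+-identityʳ i)) (m<n⇒m%n≡m (subst (i <_) i+1≡n (m<m+n i z<s)))

  -- The cell (m - 1, 3m + 1) of J₁, whose symbol wraps around to 0.
  band₁-wrap-row : ∀ {i} → i + 1 ≡ m → 1 ≤ i × i < m
  band₁-wrap-row {i} i+1≡m = ≤-by 1 (+-mono-≤ (≤-reflexive (sym i+1≡m)) 3≤m) (solve (i ∷ m ∷ [])) ,
                             subst (i <_) i+1≡m (m<m+n i z<s)

  S₂-carries : ∀ {x y s} → S₂ x y s → Carries x y s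
  S₂-carries (row₀ k 1≤k k<5)              = inj₁ (row₀ k k<5) , m<n⇒m%n≡m (<5⇒<n k<5)
  S₂-carries (band₁ i k 1≤i i<m k<3 sum<n) = inj₁ (band₁ i k 1≤i i<m k<3) , m<n⇒m%n≡m sum<n
  S₂-carries (band₁-wrap i i+1≡m)          =
    inj₁ (band₁ i 2 (proj₁ (band₁-wrap-row i+1≡m)) (proj₂ (band₁-wrap-row i+1≡m)) (s≤s (s≤s (s≤s z≤n)))) ,
    trans (cong (_% (m * 4)) sum≡n) (n%n≡0 (m * 4))
    where
    sum≡n : i + (3 * i + 4) ≡ m * 4
    sum≡n = trans (4[i+1] i) (cong (_* 4) i+1≡m)
      where
      4[i+1] : ∀ i → i + (3 * i + 4) ≡ (i + 1) * 4
      4[i+1] = solve-∀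
  S₂-carries (band₃ i y s m<i i<2m res eq s<n) =
    residue-InJ m<i i<2m (s≤s (s≤s z≤n)) res , residue-symbol res eq s<n

  S₃-carries : ∀ {x y s} → S₃ x y s → Carries x y s
  S₃-carries origin = inj₁ (row₀ 0 z<s) , m<n⇒m%n≡m 0<n
  S₃-carries row-m  = inj₁ row-m , %-wrap m+3m+2≡2+n (<5⇒<n (s≤s (s≤s (s≤s z≤n))))
    where
    m+3m+2≡2+n : 2 + m * 4 ≡ m + (3 * m + 2)
    m+3m+2≡2+n = solve (m ∷ [])
  S₃-carries (band₃ i k y s k∈02 m<i i<2m res eq s<n) =
    residue-InJ m<i i<2m (k<3 k∈02) res , residue-symbol res eq s<n
    where
    k<3 : ∀ {k} → k ≡ 0 ⊎ k ≡ 2 → k < 3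
    k<3 (inj₁ refl) = z<s
    k<3 (inj₂ refl) = s≤s (s≤s (s≤s z≤n))
  S₃-carries (back i y s 2m≤i i<n y+2m (inj₁ sum≡s) s<n) =
    inj₂ (inj₂ (back i y 2m≤i i<n y+2m)) , trans (cong (_% (m * 4)) sum≡s) (m<n⇒m%n≡m s<n)
  S₃-carries (back i y s 2m≤i i<n y+2m (inj₂ sum≡s+n) s<n) =
    inj₂ (inj₂ (back i y 2m≤i i<n y+2m)) , %-wrap (sym sum≡s+n) s<n

  residue-equation : ∀ {i k y s} → m < i → i < 2 * m → k < 3 → Residue (m * 4) (3 * i + k) y →
                     (i + y) % (m * 4) ≡ s → 4 * i + k ≡ s + m * 4
  residue-equation {i} {k} {y} {s} m<i i<2m k<3 (inj₁ (refl , _)) sum≡s = begin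
    4 * i + k                          ≡⟨ sym (4i+k i k) ⟩
    i + y                              ≡⟨ %-split n≤sum sum<2n ⟩
    (i + y) % (m * 4) + m * 4          ≡⟨ cong (_+ m * 4) sum≡s ⟩
    s + m * 4                          ∎
    where
    open ≡-Reasoning
    n≤sum : m * 4 ≤ i + (3 * i + k)
    n≤sum = ≤-by (4 + k) (scale 4 m<i) (solve (i ∷ k ∷ m ∷ []))
    sum<2n : i + (3 * i + k) < m * 4 + m * 4
    sum<2n = ≤-by 1 (+-mono-≤ (scale 4 i<2m) k<3) (solve (i ∷ k ∷ m ∷ []))
  residue-equation {i} {k} {y} {s} m<i i<2m k<3 (inj₂ (y+n , _)) sum≡s = begin
    4 * i + k                          ≡⟨ sym (4i+k i k) ⟩
    i + (3 * i + k)                    ≡⟨ cong (i +_) (sym y+n) ⟩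
    i + (y + m * 4)                    ≡⟨ sym (+-assoc i y (m * 4)) ⟩
    i + y + m * 4                      ≡⟨ cong (_+ m * 4) (trans (sym (m<n⇒m%n≡m sum<n)) sum≡s) ⟩
    s + m * 4                          ∎
    where
    open ≡-Reasoning
    sum<n : i + y < m * 4
    sum<n = ≤-by 1 (+-mono-≤ (+-mono-≤ (≤-reflexive y+n) (scale 4 i<2m)) k<3) (solve (i ∷ k ∷ y ∷ m ∷ []))

  classify-band₃ : ∀ {i k y s} → m < i → i < 2 * m → k < 3 → Residue (m * 4) (3 * i + k) y →
                   (i + y) % (m * 4) ≡ s → s < m * 4 → S₁ i y s ⊎ S₂ i y s ⊎ S₃ i y s
  classify-band₃ {i} m<i i<2m k<3@(s≤s z≤n) res sum≡s s<n =
    inj₂ (inj₂ (band₃ i 0 _ _ (inj₁ refl) m<i i<2m res (residue-equation m<i i<2m k<3 res sum≡s) s<n))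
  classify-band₃ {i} m<i i<2m k<3@(s≤s (s≤s z≤n)) res sum≡s s<n =
    inj₂ (inj₁ (band₃ i _ _ m<i i<2m res (residue-equation m<i i<2m k<3 res sum≡s) s<n))
  classify-band₃ {i} m<i i<2m k<3@(s≤s (s≤s (s≤s z≤n))) res sum≡s s<n =
    inj₂ (inj₂ (band₃ i 2 _ _ (inj₂ refl) m<i i<2m res (residue-equation m<i i<2m k<3 res sum≡s) s<n))

  classify : ∀ {x y s} → InJ x y → (x + y) % (m * 4) ≡ s → s < m * 4 → S₁ x y s ⊎ S₂ x y s ⊎ S₃ x y s
  classify (inj₁ (row₀ k k<5)) sum≡s _ = at-row₀ k k<5 sum≡s
    where
    at-row₀ : ∀ k {s} → k < 5 → (0 + k) % (m * 4) ≡ s → S₁ 0 k s ⊎ S₂ 0 k s ⊎ S₃ 0 k s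
    at-row₀ zero    _   sum≡s = inj₂ (inj₂ (subst (S₃ 0 0) (trans (sym (m<n⇒m%n≡m 0<n)) sum≡s) origin))
    at-row₀ (suc k) k<5 sum≡s =
      inj₂ (inj₁ (subst (S₂ 0 (suc k)) (trans (sym (m<n⇒m%n≡m (<5⇒<n k<5))) sum≡s) (row₀ (suc k) z<s k<5)))
  classify {s = s} (inj₁ (band₁ i k 1≤i i<m k<3)) sum≡s _ = by-size (i + (3 * i + (2 + k)) <? m * 4)
    where
    sum : ℕ
    sum = i + (3 * i + (2 + k))
    by-size : Dec (sum < m * 4) → S₁ i (3 * i + (2 + k)) s ⊎ S₂ i (3 * i + (2 + k)) s ⊎ S₃ i (3 * i + (2 + k)) s
    by-size (yes sum<n) = inj₂ (inj₁ (subst (S₂ i _) (trans (sym (m<n⇒m%n≡m sum<n)) sum≡s) (band₁ i k 1≤i i<m k<3 sum<n)))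
    by-size (no sum≮n)  = inj₂ (inj₁ (last-cell k<3 sum≡n))
      where
      sum≡n : sum ≡ m * 4
      sum≡n = ≤-antisym sum≤n (≮⇒≥ sum≮n)
        where
        sum≤n : i + (3 * i + (2 + k)) ≤ m * 4
        sum≤n = ≤-by 0 (+-mono-≤ (scale 4 i<m) k<3) (solve (i ∷ k ∷ m ∷ []))
      last-cell : k < 3 → sum ≡ m * 4 → S₂ i (3 * i + (2 + k)) s
      last-cell (s≤s z≤n)             eq = ⊥-elim (≰-by 1 (+-mono-≤ (scale 4 i<m) (≤-reflexive (sym eq′))) (solve (i ∷ m ∷ [])))
        where
        eq′ : i + (3 * i + 2) ≡ m * 4
        eq′ = eq
      last-cell (s≤s (s≤s z≤n))       eq = ⊥-elim (≰-by 0 (+-mono-≤ (scale 4 i<m) (≤-reflexive (sym eq′))) (solve (i ∷ m ∷ [])))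
        where
        eq′ : i + (3 * i + 3) ≡ m * 4
        eq′ = eq
      last-cell (s≤s (s≤s (s≤s z≤n))) eq = subst (S₂ i (3 * i + 4)) 0≡s (band₁-wrap i i+1≡m)
        where
        i+1≡m : i + 1 ≡ m
        i+1≡m = *-cancelʳ-≡ (i + 1) m 4 (trans (4[i+1] i) eq)
          where
          4[i+1] : ∀ i → (i + 1) * 4 ≡ i + (3 * i + 4)
          4[i+1] = solve-∀
        0≡s : 0 ≡ s
        0≡s = trans (sym (n%n≡0 (m * 4))) (trans (cong (_% (m * 4)) (sym eq)) sum≡s)
  classify (inj₁ row-m) sum≡s _ =
    inj₂ (inj₂ (subst (S₃ m (3 * m + 2)) (trans (sym (S₃-symbol row-m)) sum≡s) row-m))
    where
    S₃-symbol : ∀ {x y s} → S₃ x y s → (x + y) % (m * 4) ≡ s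
    S₃-symbol t = proj₂ (S₃-carries t)
  classify (inj₁ (band₃ i k m<i i<2m k<3 v<n)) sum≡s s<n =
    classify-band₃ m<i i<2m k<3 (inj₁ (refl , v<n)) sum≡s s<n
  classify (inj₂ (inj₁ (band₃-wrap i k y m<i i<2m k<3 y+n))) sum≡s s<n =
    classify-band₃ m<i i<2m k<3 (inj₂ (y+n , <2m⇒<n (wrap-col<2m i<2m k<3 y+n))) sum≡s s<n
  classify {s = s} (inj₂ (inj₁ (diagonal i 2m≤i i<n))) sum≡s s<n =
    inj₁ (diagonal i s 2m≤i i<n (trans (%-split n≤2i 2i<2n) (cong (_+ m * 4) sum≡s)) s<n)
    where
    n≤2i : m * 4 ≤ i + i
    n≤2i = ≤-by 0 (scale 2 2m≤i) (solve (i ∷ m ∷ []))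
    2i<2n : i + i < m * 4 + m * 4
    2i<2n = ≤-by 1 (scale 2 i<n) (solve (i ∷ m ∷ []))
  classify {s = s} (inj₂ (inj₂ (next i 2m≤i i+1<n))) sum≡s s<n =
    inj₁ (next i s 2m≤i i+1<n (trans (%-split n≤2i+1 2i+1<2n) (cong (_+ m * 4) sum≡s)) s<n)
    where
    n≤2i+1 : m * 4 ≤ i + (i + 1)
    n≤2i+1 = ≤-by 1 (scale 2 2m≤i) (solve (i ∷ m ∷ []))
    2i+1<2n : i + (i + 1) < m * 4 + m * 4
    2i+1<2n = ≤-by 2 (scale 2 i+1<n) (solve (i ∷ m ∷ []))
  classify (inj₂ (inj₂ (next-wrap i i+1≡n))) sum≡s s<n =
    inj₁ (subst (S₁ i 0) (trans (sym (proj₂ (S₁-carries (next-wrap i i+1≡n)))) sum≡s) (next-wrap i i+1≡n))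
  classify {s = s} (inj₂ (inj₂ (back i y 2m≤i i<n y+2m))) sum≡s s<n =
    inj₂ (inj₂ (back i y s 2m≤i i<n y+2m (by-size (i + y <? m * 4)) s<n))
    where
    by-size : Dec (i + y < m * 4) → i + y ≡ s ⊎ i + y ≡ s + m * 4
    by-size (yes sum<n) = inj₁ (trans (sym (m<n⇒m%n≡m sum<n)) sum≡s)
    by-size (no sum≮n)  = inj₂ (trans (%-split (≮⇒≥ sum≮n) sum<2n) (cong (_+ m * 4) sum≡s))
      where
      sum<2n : i + y < m * 4 + m * 4
      sum<2n = ≤-by (2 * m) (+-mono-≤ (≤-reflexive y+2m) (scale 2 i<n)) (solve (i ∷ y ∷ m ∷ []))

  S₁-unique : ∀ {x y s x′ y′ s′} → S₁ x y s → S₁ x′ y′ s′ → s ≡ s′ → (x , y) ≡ (x′ , y′)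
  S₁-unique (diagonal i s _ _ e _) (diagonal i′ s′ _ _ e′ _) es = cong (λ t → t , t) i≡i′
    where
    i≡i′ : i ≡ i′
    i≡i′ = *-cancelˡ-≡ i i′ 2 (≡-by (e +≡ sym e′ +≡ es) (solve (i ∷ i′ ∷ s ∷ s′ ∷ m ∷ [])))
  S₁-unique (diagonal i s _ _ e _) (next i′ s′ _ _ e′ _) es =
    ⊥-elim (even≢odd i i′ (≡-by (e +≡ sym e′ +≡ es) (solve (i ∷ i′ ∷ s ∷ s′ ∷ m ∷ []))))
  S₁-unique (diagonal i s _ _ e _) (next-wrap i′ e′) es =
    ⊥-elim (even≢odd (m * 4) i (≡-by (sym e +≡ sym e′ +≡ sym es) (solve (i ∷ i′ ∷ s ∷ m ∷ []))))
  S₁-unique t@(next _ _ _ _ _ _) t′@(diagonal _ _ _ _ _ _) es = sym (S₁-unique t′ t (sym es))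
  S₁-unique (next i s _ _ e _) (next i′ s′ _ _ e′ _) es = cong (λ t → t , t + 1) i≡i′
    where
    i≡i′ : i ≡ i′
    i≡i′ = *-cancelˡ-≡ i i′ 2 (≡-by (e +≡ sym e′ +≡ es) (solve (i ∷ i′ ∷ s ∷ s′ ∷ m ∷ [])))
  S₁-unique (next i s _ i+1<n e _) (next-wrap i′ e′) es =
    ⊥-elim (<-irrefl (*-cancelˡ-≡ (i + 1) (m * 4) 2 (≡-by (e +≡ e′ +≡ es) (solve (i ∷ i′ ∷ s ∷ m ∷ [])))) i+1<n)
  S₁-unique t@(next-wrap _ _) t′@(diagonal _ _ _ _ _ _) es = sym (S₁-unique t′ t (sym es))
  S₁-unique t@(next-wrap _ _) t′@(next _ _ _ _ _ _) es = sym (S₁-unique t′ t (sym es))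
  S₁-unique (next-wrap _ _) (next-wrap _ _) es = cong (_, 0) es

  S₂-unique : ∀ {x y s x′ y′ s′} → S₂ x y s → S₂ x′ y′ s′ → s ≡ s′ → (x , y) ≡ (x′ , y′)
  S₂-unique (row₀ _ _ _) (row₀ _ _ _) es = cong (0 ,_) es
  S₂-unique (row₀ k _ k<5) (band₁ i′ k′ 1≤i′ _ _ _) es =
    ⊥-elim (≰-by (1 + k′) (+-mono-≤ (+-mono-≤ k<5 (scale 4 1≤i′)) (≤-reflexive (sym es))) (solve (k ∷ i′ ∷ k′ ∷ [])))
  S₂-unique (row₀ k 1≤k _) (band₁-wrap _ _) es = ⊥-elim (n≮0 (subst (1 ≤_) es 1≤k))
  S₂-unique (row₀ k _ k<5) (band₃ i′ y′ s′ m<i′ _ _ e′ _) es =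
    ⊥-elim (≰-by 0 (+-mono-≤ (+-mono-≤ (+-mono-≤ k<5 (scale 4 m<i′)) (≤-reflexive e′)) (≤-reflexive (sym es)))
                 (solve (k ∷ i′ ∷ s′ ∷ m ∷ [])))
  S₂-unique t@(band₁ _ _ _ _ _ _) t′@(row₀ _ _ _) es = sym (S₂-unique t′ t (sym es))
  S₂-unique (band₁ i k _ _ k<3 _) (band₁ i′ k′ _ _ k′<3 _) es =
    cong₂ (λ a b → a , 3 * a + (2 + b)) (quotient-unique 4 (m<n⇒m<1+n k<3) (m<n⇒m<1+n k′<3) 4i+k≡)
                                        (remainder-unique 4 {i} {i′} (m<n⇒m<1+n k<3) (m<n⇒m<1+n k′<3) 4i+k≡)
    where
    4i+k≡ : 4 * i + k ≡ 4 * i′ + k′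
    4i+k≡ = ≡-by es (solve (i ∷ k ∷ i′ ∷ k′ ∷ []))
  S₂-unique (band₁ i k _ _ _ _) (band₁-wrap _ _) es = ⊥-elim (≰-by (4 * i + 1 + k) (≤-reflexive es) (solve (i ∷ k ∷ [])))
  S₂-unique (band₁ i k _ _ k<3 _) (band₃ i′ y′ s′ _ _ _ e′ _) es = ⊥-elim (mismatch k<3)
    where
    -- 4i + 2 + k + n = 4i′ + 1 is impossible modulo 4.
    mismatch : k < 3 → ⊥
    mismatch (s≤s z≤n) = remainder-≢ 4 (i + m) i′ (s≤s (s≤s (s≤s z≤n))) (s≤s (s≤s z≤n)) (λ ())
      (≡-by (es +≡ sym e′) (solve (i ∷ i′ ∷ s′ ∷ m ∷ [])))
    mismatch (s≤s (s≤s z≤n)) = remainder-≢ 4 (i + m) i′ (s≤s (s≤s (s≤s (s≤s z≤n)))) (s≤s (s≤s z≤n)) (λ ())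
      (≡-by (es +≡ sym e′) (solve (i ∷ i′ ∷ s′ ∷ m ∷ [])))
    mismatch (s≤s (s≤s (s≤s z≤n))) = remainder-≢ 4 (i + m + 1) i′ z<s (s≤s (s≤s z≤n)) (λ ())
      (≡-by (es +≡ sym e′) (solve (i ∷ i′ ∷ s′ ∷ m ∷ [])))
  S₂-unique t@(band₁-wrap _ _) t′@(row₀ _ _ _) es = sym (S₂-unique t′ t (sym es))
  S₂-unique t@(band₁-wrap _ _) t′@(band₁ _ _ _ _ _ _) es = sym (S₂-unique t′ t (sym es))
  S₂-unique (band₁-wrap i e) (band₁-wrap i′ e′) _ = cong (λ a → a , 3 * a + 4) (+-cancelʳ-≡ 1 i i′ (trans e (sym e′)))
  S₂-unique (band₁-wrap _ _) (band₃ i′ y′ s′ _ _ _ e′ _) es =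
    ⊥-elim (remainder-≢ 4 m i′ z<s (s≤s (s≤s z≤n)) (λ ()) (≡-by (sym e′ +≡ es) (solve (i′ ∷ s′ ∷ m ∷ []))))
  S₂-unique t@(band₃ _ _ _ _ _ _ _ _) t′@(row₀ _ _ _) es = sym (S₂-unique t′ t (sym es))
  S₂-unique t@(band₃ _ _ _ _ _ _ _ _) t′@(band₁ _ _ _ _ _ _) es = sym (S₂-unique t′ t (sym es))
  S₂-unique t@(band₃ _ _ _ _ _ _ _ _) t′@(band₁-wrap _ _) es = sym (S₂-unique t′ t (sym es))
  S₂-unique (band₃ i y s _ _ res e _) (band₃ i′ y′ s′ _ _ res′ e′ _) es = same-row i≡i′ res′
    where
    i≡i′ : i ≡ i′
    i≡i′ = *-cancelˡ-≡ i i′ 4 (≡-by (e +≡ sym e′ +≡ es) (solve (i ∷ i′ ∷ s ∷ s′ ∷ m ∷ [])))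
    same-row : i ≡ i′ → Residue (m * 4) (3 * i′ + 1) y′ → (i , y) ≡ (i′ , y′)
    same-row refl res′ = cong (i ,_) (residue-unique res res′)

  S₃-symbol-0 : ∀ {x′ y′ s′} → S₃ x′ y′ s′ → 0 ≡ s′ → (0 , 0) ≡ (x′ , y′)
  S₃-symbol-0 origin _ = refl
  S₃-symbol-0 row-m ()
  S₃-symbol-0 (band₃ i′ k′ y′ s′ _ m<i′ _ _ e′ _) es =
    ⊥-elim (≰-by (3 + k′) (+-mono-≤ (+-mono-≤ (scale 4 m<i′) (≤-reflexive e′)) (≤-reflexive (sym es)))
                          (solve (i′ ∷ k′ ∷ s′ ∷ m ∷ [])))
  S₃-symbol-0 (back i′ y′ s′ 2m≤i′ _ _ (inj₁ sum≡s′) _) es =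
    ⊥-elim (≰-by (m + y′ + 2) (+-mono-≤ (+-mono-≤ (+-mono-≤ 2m≤i′ (≤-reflexive sum≡s′)) (≤-reflexive (sym es))) 3≤m)
                              (solve (i′ ∷ y′ ∷ s′ ∷ m ∷ [])))
  S₃-symbol-0 (back i′ y′ s′ _ _ e′ (inj₂ sum≡s′+n) _) es =
    ⊥-elim (even≢odd (3 * m) i′ (≡-by (sym sum≡s′+n +≡ e′ +≡ es) (solve (i′ ∷ y′ ∷ s′ ∷ m ∷ []))))

  S₃-symbol-2 : ∀ {x′ y′ s′} → S₃ x′ y′ s′ → 2 ≡ s′ → (m , 3 * m + 2) ≡ (x′ , y′)
  S₃-symbol-2 origin ()
  S₃-symbol-2 row-m _ = refl
  S₃-symbol-2 (band₃ i′ .0 y′ s′ (inj₁ refl) _ _ _ e′ _) es =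
    ⊥-elim (remainder-≢ 4 i′ m z<s (s≤s (s≤s (s≤s z≤n))) (λ ()) (≡-by (e′ +≡ sym es) (solve (i′ ∷ s′ ∷ m ∷ []))))
  S₃-symbol-2 (band₃ i′ .2 y′ s′ (inj₂ refl) m<i′ _ _ e′ _) es =
    ⊥-elim (<-irrefl (*-cancelˡ-≡ m i′ 4 (≡-by (sym e′ +≡ es) (solve (i′ ∷ s′ ∷ m ∷ [])))) m<i′)
  S₃-symbol-2 (back i′ y′ s′ _ _ e′ (inj₁ sum≡s′) _) es =
    ⊥-elim (even≢odd (m + 1) i′ (≡-by (sym sum≡s′ +≡ e′ +≡ es) (solve (i′ ∷ y′ ∷ s′ ∷ m ∷ []))))
  S₃-symbol-2 (back i′ y′ s′ _ _ e′ (inj₂ sum≡s′+n) _) es =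
    ⊥-elim (even≢odd (3 * m + 1) i′ (≡-by (sym sum≡s′+n +≡ e′ +≡ es) (solve (i′ ∷ y′ ∷ s′ ∷ m ∷ []))))

  -- A column of J₃ and a cell (i, i - 2m + 1) of J₄ never share a symbol:
  -- 4i + k is even, while i′ + y′ + 2m = 2i′ + 1 is odd.
  band₃≢back : ∀ i {k s} i′ {y′ s′} → k ≡ 0 ⊎ k ≡ 2 → 4 * i + k ≡ s + m * 4 → y′ + 2 * m ≡ i′ + 1 →
               i′ + y′ ≡ s′ ⊎ i′ + y′ ≡ s′ + m * 4 → s ≡ s′ → ⊥
  band₃≢back i {s = s} i′ {y′} {s′} (inj₁ refl) e e′ (inj₁ sum≡s′) es =
    even≢odd (2 * i) (i′ + m) (≡-by (e +≡ e′ +≡ sym sum≡s′ +≡ es) (solve (i ∷ i′ ∷ y′ ∷ s ∷ s′ ∷ m ∷ [])))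
  band₃≢back i {s = s} i′ {y′} {s′} (inj₂ refl) e e′ (inj₁ sum≡s′) es =
    even≢odd (2 * i + 1) (i′ + m) (≡-by (e +≡ e′ +≡ sym sum≡s′ +≡ es) (solve (i ∷ i′ ∷ y′ ∷ s ∷ s′ ∷ m ∷ [])))
  band₃≢back i {s = s} i′ {y′} {s′} (inj₁ refl) e e′ (inj₂ sum≡s′+n) es =
    even≢odd (2 * i + m) i′ (≡-by (e +≡ e′ +≡ sym sum≡s′+n +≡ es) (solve (i ∷ i′ ∷ y′ ∷ s ∷ s′ ∷ m ∷ [])))
  band₃≢back i {s = s} i′ {y′} {s′} (inj₂ refl) e e′ (inj₂ sum≡s′+n) es =
    even≢odd (2 * i + 1 + m) i′ (≡-by (e +≡ e′ +≡ sym sum≡s′+n +≡ es) (solve (i ∷ i′ ∷ y′ ∷ s ∷ s′ ∷ m ∷ [])))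

  S₃-unique : ∀ {x y s x′ y′ s′} → S₃ x y s → S₃ x′ y′ s′ → s ≡ s′ → (x , y) ≡ (x′ , y′)
  S₃-unique origin t′ es = S₃-symbol-0 t′ es
  S₃-unique row-m  t′ es = S₃-symbol-2 t′ es
  S₃-unique t@(band₃ _ _ _ _ _ _ _ _ _ _) origin es = sym (S₃-symbol-0 t (sym es))
  S₃-unique t@(band₃ _ _ _ _ _ _ _ _ _ _) row-m  es = sym (S₃-symbol-2 t (sym es))
  S₃-unique (band₃ i k y s k∈ _ _ res e _) (band₃ i′ k′ y′ s′ k′∈ _ _ res′ e′ _) es = same-row i≡i′ k≡k′ res′
    where
    k<4 : ∀ {k} → k ≡ 0 ⊎ k ≡ 2 → k < 4
    k<4 (inj₁ refl) = z<s
    k<4 (inj₂ refl) = s≤s (s≤s (s≤s z≤n))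
    4i+k≡ : 4 * i + k ≡ 4 * i′ + k′
    4i+k≡ = ≡-by (e +≡ sym e′ +≡ es) (solve (i ∷ k ∷ i′ ∷ k′ ∷ s ∷ s′ ∷ m ∷ []))
    i≡i′ : i ≡ i′
    i≡i′ = quotient-unique 4 (k<4 k∈) (k<4 k′∈) 4i+k≡
    k≡k′ : k ≡ k′
    k≡k′ = remainder-unique 4 {i} {i′} (k<4 k∈) (k<4 k′∈) 4i+k≡
    same-row : i ≡ i′ → k ≡ k′ → Residue (m * 4) (3 * i′ + k′) y′ → (i , y) ≡ (i′ , y′)
    same-row refl refl res′ = cong (i ,_) (residue-unique res res′)
  S₃-unique (band₃ i _ _ _ k∈ _ _ _ e _) (back i′ _ _ _ _ e′ sum′ _) es = ⊥-elim (band₃≢back i i′ k∈ e e′ sum′ es)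
  S₃-unique t@(back _ _ _ _ _ _ _ _) origin es = sym (S₃-symbol-0 t (sym es))
  S₃-unique t@(back _ _ _ _ _ _ _ _) row-m  es = sym (S₃-symbol-2 t (sym es))
  S₃-unique (back i _ _ _ _ e sum _) (band₃ i′ _ _ _ k∈ _ _ _ e′ _) es = ⊥-elim (band₃≢back i′ i k∈ e′ e sum (sym es))
  S₃-unique (back i y s 2m≤i i<n e sum _) (back i′ y′ s′ 2m≤i′ i′<n e′ sum′ _) es = by-sums sum sum′
    where
    same : i ≡ i′ → (i , y) ≡ (i′ , y′)
    same refl = cong (i ,_) (+-cancelʳ-≡ (2 * m) y y′ (trans e (sym e′)))
    apart : ∀ {a b} → 2 * m ≤ a → b < m * 4 → 2 * b + 1 ≡ 2 * a + 1 + m * 4 → ⊥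
    apart {a} {b} 2m≤a b<n eq =
      ≰-by 1 (+-mono-≤ (+-mono-≤ (scale 2 b<n) (scale 2 2m≤a)) (≤-reflexive (sym eq))) (solve (a ∷ b ∷ m ∷ []))
    by-sums : i + y ≡ s ⊎ i + y ≡ s + m * 4 → i′ + y′ ≡ s′ ⊎ i′ + y′ ≡ s′ + m * 4 → (i , y) ≡ (i′ , y′)
    by-sums (inj₁ a) (inj₁ b) =
      same (*-cancelˡ-≡ i i′ 2 (≡-by (a +≡ sym b +≡ es +≡ sym e +≡ e′) (solve (i ∷ y ∷ i′ ∷ y′ ∷ s ∷ s′ ∷ m ∷ []))))
    by-sums (inj₂ a) (inj₂ b) =
      same (*-cancelˡ-≡ i i′ 2 (≡-by (a +≡ sym b +≡ es +≡ sym e +≡ e′) (solve (i ∷ y ∷ i′ ∷ y′ ∷ s ∷ s′ ∷ m ∷ []))))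
    by-sums (inj₁ a) (inj₂ b) =
      ⊥-elim (apart 2m≤i i′<n (≡-by (sym a +≡ b +≡ sym es +≡ e +≡ sym e′) (solve (i ∷ y ∷ i′ ∷ y′ ∷ s ∷ s′ ∷ m ∷ []))))
    by-sums (inj₂ a) (inj₁ b) =
      ⊥-elim (apart 2m≤i′ i<n (≡-by (a +≡ sym b +≡ es +≡ sym e +≡ e′) (solve (i ∷ y ∷ i′ ∷ y′ ∷ s ∷ s′ ∷ m ∷ []))))

  S₁-exists : ∀ s → s < m * 4 → Σ[ x ∈ ℕ ] Σ[ y ∈ ℕ ] S₁ x y s
  S₁-exists s s<n = by-parity (divide 2 s)
    where
    by-parity : Σ[ q ∈ ℕ ] Σ[ r ∈ ℕ ] r < 2 × s ≡ 2 * q + r → Σ[ x ∈ ℕ ] Σ[ y ∈ ℕ ] S₁ x y s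
    by-parity (q , 0 , _ , refl) = 2 * m + q , 2 * m + q ,
      diagonal (2 * m + q) _ (m≤m+n (2 * m) q) (≤-by 0 q<2m (solve (q ∷ m ∷ []))) (solve (q ∷ m ∷ [])) s<n
      where
      q<2m : q < 2 * m
      q<2m = quotient-< 2 (subst (2 * q + 0 <_) n≡2[2m] s<n)
        where
        n≡2[2m] : m * 4 ≡ 2 * (2 * m)
        n≡2[2m] = solve (m ∷ [])
    by-parity (q , suc (suc r) , s≤s (s≤s ()) , _)
    by-parity (q , 1 , _ , refl) = odd (suc q <? 2 * m)
      where
      odd : Dec (suc q < 2 * m) → Σ[ x ∈ ℕ ] Σ[ y ∈ ℕ ] S₁ x y (2 * q + 1)
      odd (yes q+1<2m) = 2 * m + q , 2 * m + q + 1 ,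
        next (2 * m + q) _ (m≤m+n (2 * m) q) (≤-by 0 q+1<2m (solve (q ∷ m ∷ []))) (solve (q ∷ m ∷ [])) s<n
      odd (no q+1≮2m)  = 2 * q + 1 , 0 , next-wrap (2 * q + 1) (≤-antisym (≤-by 0 s<n (solve (q ∷ m ∷ [])))
                                                              (≤-by 0 (scale 2 (≮⇒≥ q+1≮2m)) (solve (q ∷ m ∷ []))))

  quotient<m : ∀ {q r} → 4 * q + r < m * 4 → q < m
  quotient<m {q} {r} lt = quotient-< 4 (subst (4 * q + r <_) (*-comm m 4) lt)

  band₃-middle : ∀ q → 1 ≤ q → q < m → Σ[ y ∈ ℕ ] S₂ (m + q) y (4 * q + 1)
  band₃-middle q 1≤q q<m = middle (residue-exists (band₃<2n m+q<2m (s≤s (s≤s z≤n))))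
    where
    m<m+q : m < m + q
    m<m+q = ≤-by 0 1≤q (solve (q ∷ m ∷ []))
    m+q<2m : m + q < 2 * m
    m+q<2m = ≤-by 0 q<m (solve (q ∷ m ∷ []))
    s<n : 4 * q + 1 < m * 4
    s<n = ≤-by 2 (scale 4 q<m) (solve (q ∷ m ∷ []))
    middle : Σ[ y ∈ ℕ ] Residue (m * 4) (3 * (m + q) + 1) y → Σ[ y ∈ ℕ ] S₂ (m + q) y (4 * q + 1)
    middle (y , res) = y , band₃ (m + q) y (4 * q + 1) m<m+q m+q<2m res (solve (q ∷ m ∷ [])) s<n

  band₁-symbol : ∀ q k → 1 ≤ q → q < m → k < 3 → 4 * q + (2 + k) < m * 4 → S₂ q (3 * q + (2 + k)) (4 * q + (2 + k))
  band₁-symbol q k 1≤q q<m k<3 sum<n =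
    subst (S₂ q (3 * q + (2 + k))) (4i+k q (2 + k)) (band₁ q k 1≤q q<m k<3 (subst (_< m * 4) (sym (4i+k q (2 + k))) sum<n))

  S₂-exists : ∀ s → s < m * 4 → Σ[ x ∈ ℕ ] Σ[ y ∈ ℕ ] S₂ x y s
  S₂-exists zero    _   = m ∸ 1 , 3 * (m ∸ 1) + 4 , band₁-wrap (m ∸ 1) (m∸n+n≡m 0<m)
  S₂-exists (suc s) s<n = by-size (suc s ≤? 4)
    where
    by-residue : suc s ≰ 4 → Σ[ q ∈ ℕ ] Σ[ r ∈ ℕ ] r < 4 × suc s ≡ 4 * q + r → Σ[ x ∈ ℕ ] Σ[ y ∈ ℕ ] S₂ x y (suc s)
    by-residue s≰4 (0 , r , r<4 , eq) = ⊥-elim (s≰4 (≤-trans (≤-reflexive eq) (<⇒≤ r<4)))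
    by-residue s≰4 (1 , 0 , _ , refl) = ⊥-elim (s≰4 ≤-refl)
    by-residue s≰4 (suc (suc q) , 0 , _ , refl) = suc q , _ ,
      subst (S₂ (suc q) _) (shift q)
        (band₁-symbol (suc q) 2 (s≤s z≤n) (<-trans (n<1+n (suc q)) (quotient<m s<n)) (s≤s (s≤s (s≤s z≤n)))
                      (subst (_< m * 4) (sym (shift q)) s<n))
      where
      shift : ∀ q → 4 * suc q + (2 + 2) ≡ 4 * suc (suc q) + 0
      shift = solve-∀
    by-residue s≰4 (suc q , 1 , _ , refl) = m + suc q , band₃-middle (suc q) (s≤s z≤n) (quotient<m s<n)
    by-residue s≰4 (suc q , 2 , _ , refl) = suc q , _ , band₁-symbol (suc q) 0 (s≤s z≤n) (quotient<m s<n) z<s s<n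
    by-residue s≰4 (suc q , 3 , _ , refl) = suc q , _ , band₁-symbol (suc q) 1 (s≤s z≤n) (quotient<m s<n) (s≤s (s≤s z≤n)) s<n
    by-residue s≰4 (suc q , suc (suc (suc (suc r))) , s≤s (s≤s (s≤s (s≤s ()))) , _)
    by-size : Dec (suc s ≤ 4) → Σ[ x ∈ ℕ ] Σ[ y ∈ ℕ ] S₂ x y (suc s)
    by-size (yes s≤4) = 0 , suc s , row₀ (suc s) (s≤s z≤n) (s≤s s≤4)
    by-size (no s≰4)  = by-residue s≰4 (divide 4 (suc s))

  back-symbol : ∀ t → 2 * t + 1 < m * 4 → Σ[ x ∈ ℕ ] Σ[ y ∈ ℕ ] S₃ x y (2 * t + 1)
  back-symbol t s<n = by-size (t <? m)
    where
    by-size : Dec (t < m) → Σ[ x ∈ ℕ ] Σ[ y ∈ ℕ ] S₃ x y (2 * t + 1)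
    by-size (yes t<m) = 3 * m + t , m + t + 1 ,
      back (3 * m + t) (m + t + 1) _ (≤-by (m + t) (≤-refl {0}) (solve (t ∷ m ∷ []))) (≤-by 0 t<m (solve (t ∷ m ∷ [])))
           (solve (t ∷ m ∷ [])) (inj₂ (solve (t ∷ m ∷ []))) s<n
    by-size (no t≮m) with m≤n⇒∃[o]m+o≡n (≮⇒≥ t≮m)
    ... | u , refl = 2 * m + u , u + 1 ,
      back (2 * m + u) (u + 1) _ (m≤m+n (2 * m) u) (≤-by (1 + u) s<n (solve (u ∷ m ∷ [])))
           (solve (u ∷ m ∷ [])) (inj₁ (solve (u ∷ m ∷ []))) s<n

  band₃-outer : ∀ q k → k ≡ 0 ⊎ k ≡ 2 → 1 ≤ q → q < m → Σ[ y ∈ ℕ ] S₃ (m + q) y (4 * q + k)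
  band₃-outer q k k∈ 1≤q q<m = outer (residue-exists (band₃<2n m+q<2m k<3))
    where
    k<3 : k < 3
    k<3 = [ (λ { refl → z<s }) , (λ { refl → s≤s (s≤s (s≤s z≤n)) }) ]′ k∈
    m<m+q : m < m + q
    m<m+q = ≤-by 0 1≤q (solve (q ∷ m ∷ []))
    m+q<2m : m + q < 2 * m
    m+q<2m = ≤-by 0 q<m (solve (q ∷ m ∷ []))
    s<n : 4 * q + k < m * 4
    s<n = ≤-by 1 (+-mono-≤ (scale 4 q<m) k<3) (solve (q ∷ k ∷ m ∷ []))
    outer : Σ[ y ∈ ℕ ] Residue (m * 4) (3 * (m + q) + k) y → Σ[ y ∈ ℕ ] S₃ (m + q) y (4 * q + k)
    outer (y , res) = y , band₃ (m + q) k y (4 * q + k) k∈ m<m+q m+q<2m res (solve (q ∷ k ∷ m ∷ [])) s<n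

  S₃-exists : ∀ s → s < m * 4 → Σ[ x ∈ ℕ ] Σ[ y ∈ ℕ ] S₃ x y s
  S₃-exists s s<n = by-residue (divide 4 s)
    where
    by-residue : Σ[ q ∈ ℕ ] Σ[ r ∈ ℕ ] r < 4 × s ≡ 4 * q + r → Σ[ x ∈ ℕ ] Σ[ y ∈ ℕ ] S₃ x y s
    by-residue (0 , 0 , _ , refl) = 0 , 0 , origin
    by-residue (suc q , 0 , _ , refl) = m + suc q , band₃-outer (suc q) 0 (inj₁ refl) (s≤s z≤n) (quotient<m s<n)
    by-residue (q , 1 , _ , refl) =
      subst (λ t → Σ[ x ∈ ℕ ] Σ[ y ∈ ℕ ] S₃ x y t) (odd q) (back-symbol (2 * q) (subst (_< m * 4) (sym (odd q)) s<n))
      where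
      odd : ∀ q → 2 * (2 * q) + 1 ≡ 4 * q + 1
      odd = solve-∀
    by-residue (0 , 2 , _ , refl) = m , 3 * m + 2 , row-m
    by-residue (suc q , 2 , _ , refl) = m + suc q , band₃-outer (suc q) 2 (inj₂ refl) (s≤s z≤n) (quotient<m s<n)
    by-residue (q , 3 , _ , refl) =
      subst (λ t → Σ[ x ∈ ℕ ] Σ[ y ∈ ℕ ] S₃ x y t) (odd q) (back-symbol (2 * q + 1) (subst (_< m * 4) (sym (odd q)) s<n))
      where
      odd : ∀ q → 2 * (2 * q + 1) + 1 ≡ 4 * q + 3
      odd = solve-∀
    by-residue (q , suc (suc (suc (suc r))) , s≤s (s≤s (s≤s (s≤s ()))) , _)

  S₁-row : ∀ {x y s} → S₁ x y s → 2 * m ≤ x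
  S₁-row (diagonal _ _ 2m≤i _ _ _) = 2m≤i
  S₁-row (next _ _ 2m≤i _ _ _)     = 2m≤i
  S₁-row (next-wrap i i+1≡n)       = T₃-row (next-wrap i i+1≡n)

  S₂-row : ∀ {x y s} → S₂ x y s → x < 2 * m
  S₂-row (row₀ _ _ _)            = <-trans 0<m m<2m
  S₂-row (band₁ _ _ _ i<m _ _)   = <m⇒<2m i<m
  S₂-row (band₁-wrap i i+1≡m)    = <m⇒<2m (proj₂ (band₁-wrap-row i+1≡m))
  S₂-row (band₃ _ _ _ _ i<2m _ _ _) = i<2m

  S₁≢S₂ : ∀ {x y s x′ y′ s′} → S₁ x y s → S₂ x′ y′ s′ → (x , y) ≢ (x′ , y′)
  S₁≢S₂ t t′ eq = <⇒≱ (S₂-row t′) (subst (2 * m ≤_) (cong proj₁ eq) (S₁-row t))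

  S₁≢S₃ : ∀ {x y s x′ y′ s′} → S₁ x y s → S₃ x′ y′ s′ → (x , y) ≢ (x′ , y′)
  S₁≢S₃ t origin eq = <⇒≱ (<-trans 0<m m<2m) (subst (2 * m ≤_) (cong proj₁ eq) (S₁-row t))
  S₁≢S₃ t row-m  eq = <⇒≱ m<2m (subst (2 * m ≤_) (cong proj₁ eq) (S₁-row t))
  S₁≢S₃ t (band₃ _ _ _ _ _ _ i<2m _ _ _) eq = <⇒≱ i<2m (subst (2 * m ≤_) (cong proj₁ eq) (S₁-row t))
  S₁≢S₃ (diagonal i _ _ _ _ _) (back i′ y′ _ _ _ e′ _ _) eq =
    ≰-by (m + 1) (+-mono-≤ (≤-reflexive (+-cancelˡ-≡ i (2 * m) 1 i+2m≡i+1)) 3≤m) (solve (m ∷ []))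
    where
    i+2m≡i+1 : i + 2 * m ≡ i + 1
    i+2m≡i+1 = trans (cong (_+ 2 * m) (cong proj₂ eq)) (trans e′ (cong (_+ 1) (sym (cong proj₁ eq))))
  S₁≢S₃ (next i _ _ _ _ _) (back i′ y′ _ _ _ e′ _ _) eq =
    ≰-by (m + 2) (+-mono-≤ (≤-reflexive (+-cancelˡ-≡ (i + 1) (2 * m) 0 i+1+2m≡i+1)) 3≤m) (solve (m ∷ []))
    where
    i+1+2m≡i+1 : i + 1 + 2 * m ≡ i + 1 + 0
    i+1+2m≡i+1 = trans (cong (_+ 2 * m) (cong proj₂ eq))
                   (trans e′ (trans (cong (_+ 1) (sym (cong proj₁ eq))) (sym (+-identityʳ (i + 1)))))
  S₁≢S₃ (next-wrap i _) (back i′ y′ _ 2m≤i′ _ e′ _ _) eq =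
    n≮0 (subst (0 <_) (sym (cong proj₂ eq)) (back-col≥1 2m≤i′ e′))

  S₂≢S₃ : ∀ {x y s x′ y′ s′} → S₂ x y s → S₃ x′ y′ s′ → s ≡ s′ → (x , y) ≢ (x′ , y′)
  S₂≢S₃ (row₀ k 1≤k _) origin _ eq = n≮0 (subst (0 <_) (cong proj₂ eq) 1≤k)
  S₂≢S₃ (row₀ _ _ _) row-m _ eq = <-irrefl (cong proj₁ eq) 0<m
  S₂≢S₃ (row₀ _ _ _) (band₃ _ _ _ _ _ m<i′ _ _ _ _) _ eq = <-irrefl (cong proj₁ eq) (<-trans 0<m m<i′)
  S₂≢S₃ (row₀ _ _ _) (back _ _ _ 2m≤i′ _ _ _ _) _ eq = <-irrefl (cong proj₁ eq) (<-≤-trans (<-trans 0<m m<2m) 2m≤i′)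
  S₂≢S₃ (band₁ _ _ 1≤i _ _ _) origin _ eq = <-irrefl (sym (cong proj₁ eq)) 1≤i
  S₂≢S₃ (band₁ _ _ _ i<m _ _) row-m _ eq = <-irrefl (cong proj₁ eq) i<m
  S₂≢S₃ (band₁ _ _ _ i<m _ _) (band₃ _ _ _ _ _ m<i′ _ _ _ _) _ eq = <-irrefl (cong proj₁ eq) (<-trans i<m m<i′)
  S₂≢S₃ (band₁ _ _ _ i<m _ _) (back _ _ _ 2m≤i′ _ _ _ _) _ eq = <-irrefl (cong proj₁ eq) (<-≤-trans (<m⇒<2m i<m) 2m≤i′)
  S₂≢S₃ (band₁-wrap _ i+1≡m) origin _ eq = <-irrefl (sym (cong proj₁ eq)) (proj₁ (band₁-wrap-row i+1≡m))
  S₂≢S₃ (band₁-wrap _ i+1≡m) row-m _ eq = <-irrefl (cong proj₁ eq) (proj₂ (band₁-wrap-row i+1≡m))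
  S₂≢S₃ (band₁-wrap _ i+1≡m) (band₃ _ _ _ _ _ m<i′ _ _ _ _) _ eq =
    <-irrefl (cong proj₁ eq) (<-trans (proj₂ (band₁-wrap-row i+1≡m)) m<i′)
  S₂≢S₃ (band₁-wrap _ i+1≡m) (back _ _ _ 2m≤i′ _ _ _ _) _ eq =
    <-irrefl (cong proj₁ eq) (<-≤-trans (<m⇒<2m (proj₂ (band₁-wrap-row i+1≡m))) 2m≤i′)
  S₂≢S₃ (band₃ _ _ _ m<i _ _ _ _) origin _ eq = <-irrefl (sym (cong proj₁ eq)) (<-trans 0<m m<i)
  S₂≢S₃ (band₃ _ _ _ m<i _ _ _ _) row-m _ eq = <-irrefl (sym (cong proj₁ eq)) m<i
  S₂≢S₃ (band₃ i _ s _ _ _ e _) (band₃ i′ k′ _ s′ k′∈ _ _ _ e′ _) es _ = residues k′∈ (≡-by (e +≡ sym e′ +≡ es) (solve (i ∷ i′ ∷ k′ ∷ s ∷ s′ ∷ m ∷ [])))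
    where
    -- the middle column has symbol 1 modulo 4, the outer ones 0 or 2
    residues : k′ ≡ 0 ⊎ k′ ≡ 2 → 4 * i + 1 ≢ 4 * i′ + k′
    residues (inj₁ refl) = remainder-≢ 4 i i′ (s≤s (s≤s z≤n)) z<s (λ ())
    residues (inj₂ refl) = remainder-≢ 4 i i′ (s≤s (s≤s z≤n)) (s≤s (s≤s (s≤s z≤n))) (λ ())
  S₂≢S₃ (band₃ _ _ _ _ i<2m _ _ _) (back _ _ _ 2m≤i′ _ _ _ _) _ eq = <-irrefl (cong proj₁ eq) (<-≤-trans i<2m 2m≤i′)

  symbol-count : ∀ s → s < m * 4 → symCount (m * 4) s ≡ 3
  symbol-count s s<n = from-witnesses (S₁-exists s s<n) (S₂-exists s s<n) (S₃-exists s s<n)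
    where
    from-witnesses : Σ[ x ∈ ℕ ] Σ[ y ∈ ℕ ] S₁ x y s → Σ[ x ∈ ℕ ] Σ[ y ∈ ℕ ] S₂ x y s →
                     Σ[ x ∈ ℕ ] Σ[ y ∈ ℕ ] S₃ x y s → symCount (m * 4) s ≡ 3
    from-witnesses (x₁ , y₁ , t₁) (x₂ , y₂ , t₂) (x₃ , y₃ , t₃) =
      count-exactly (λ p → ((proj₁ p + proj₂ p) % (m * 4) ≟ s) ×-dec (p ∈? J (m * 4))) (cells-unique (m * 4))
        (unique₃ (S₁≢S₂ t₁ t₂) (S₁≢S₃ t₁ t₃) (S₂≢S₃ t₂ t₃ refl)) sound complete
      where
      W : List Cell
      W = (x₁ , y₁) ∷ (x₂ , y₂) ∷ (x₃ , y₃) ∷ []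
      carries : ∀ {c} → c ∈ W → Carries (proj₁ c) (proj₂ c) s
      carries (here refl)                 = S₁-carries t₁
      carries (there (here refl))         = S₂-carries t₂
      carries (there (there (here refl))) = S₃-carries t₃
      sound : ∀ {c} → c ∈ W → c ∈ cells (m * 4) × ((proj₁ c + proj₂ c) % (m * 4) ≡ s × c ∈ J (m * 4))
      sound c∈W = let (inJ , symbol) = carries c∈W in
        ∈-cells (InJ-row<n inJ) (InJ-col<n inJ) , symbol , InJ⇒J inJ
      locate : ∀ {x y} → S₁ x y s ⊎ S₂ x y s ⊎ S₃ x y s → (x , y) ∈ W
      locate (inj₁ t)        = here (S₁-unique t t₁ refl)
      locate (inj₂ (inj₁ t)) = there (here (S₂-unique t t₂ refl))
      locate (inj₂ (inj₂ t)) = there (there (here (S₃-unique t t₃ refl)))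
      complete : ∀ {c} → c ∈ cells (m * 4) → (proj₁ c + proj₂ c) % (m * 4) ≡ s × c ∈ J (m * 4) → c ∈ W
      complete {x , y} _ (symbol , c∈J) = locate (classify (J⇒InJ c∈J) symbol s<n)

Conclusion : (n : ℕ) → .{{_ : NonZero n}} → Set
Conclusion n =
  ((c : ℕ) → c < n → colCount n c ≡ 3) ×
  ((s : ℕ) → s < n → symCount n s ≡ 3) ×
  ((r : ℕ) → r < n → r ≢ 0 → r ≢ n / 4 → rowCount n r ≡ 3) ×
  rowCount n 0 ≡ 5 ×
  rowCount n (n / 4) ≡ 1

large-case : ∀ m .{{_ : NonZero (m * 4)}} → 3 ≤ m → Conclusion (m * 4)
large-case m 3≤m =
  column-count , symbol-count ,
  (λ r r<n r≢0 r≢n/4 → row-other r r<n r≢0 (λ r≡m → r≢n/4 (trans r≡m (sym n/4≡m)))) ,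
  row-0 ,
  row-n/4
  where open Design m 3≤m

by-evaluation : ∀ {P : ℕ → Set} (P? : Decidable P) n → {True (All.all? P? (upTo n))} → ∀ c → c < n → P c
by-evaluation P? n {checked} c c<n = All.lookup (toWitness checked) (∈-upTo⁺ c<n)

small-case : Conclusion 8
small-case =
  by-evaluation (λ c → colCount 8 c ≟ 3) 8 ,
  by-evaluation (λ s → symCount 8 s ≟ 3) 8 ,
  (λ r r<8 r≢0 r≢2 → rows r≢0 r≢2 (by-evaluation row? 8 r r<8)) ,
  refl ,
  refl
  where
  row? : Decidable (λ r → r ≡ 0 ⊎ r ≡ 2 ⊎ rowCount 8 r ≡ 3)
  row? r = (r ≟ 0) ⊎-dec (r ≟ 2) ⊎-dec (rowCount 8 r ≟ 3)
  rows : ∀ {r} → r ≢ 0 → r ≢ 2 → r ≡ 0 ⊎ r ≡ 2 ⊎ rowCount 8 r ≡ 3 → rowCount 8 r ≡ 3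
  rows r≢0 _   (inj₁ r≡0)          = ⊥-elim (r≢0 r≡0)
  rows _   r≢2 (inj₂ (inj₁ r≡2))   = ⊥-elim (r≢2 r≡2)
  rows _   _   (inj₂ (inj₂ three)) = three

lemma4p2 : (n : ℕ) → .{{_ : NonZero n}} → 8 ≤ n → 4 ∣ n →
    ((c : ℕ) → c < n → colCount n c ≡ 3) ×
    ((s : ℕ) → s < n → symCount n s ≡ 3) ×
    ((r : ℕ) → r < n → r ≢ 0 → r ≢ n / 4 → rowCount n r ≡ 3) ×
    rowCount n 0 ≡ 5 ×
    rowCount n (n / 4) ≡ 1
lemma4p2 .(q * 4) 8≤n (divides q refl) = by-quotient q 8≤n
  where
  by-quotient : ∀ q → .{{_ : NonZero (q * 4)}} → 8 ≤ q * 4 → Conclusion (q * 4)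
  by-quotient 0 ()
  by-quotient 1 (s≤s (s≤s (s≤s (s≤s ()))))
  by-quotient 2 _ = small-case
  by-quotient q@(suc (suc (suc _))) _ = large-case q (s≤s (s≤s (s≤s z≤n)))
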